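{- There is an absolute constant $C>0$ such that the following holds. Let $k\geq 3$ and $n\geq 2^{k-1}$ be integers, and let $A\subseteq\{1,2,\ldots,n\}$ be a set that contains no $k$-term geometric progression. Then \[ n-|A| \;\geq\; \left( \frac{1}{2^k -1} + \frac{2}{5}\left( \frac{1}{5^{k-1}} - \frac{1}{6^{k-1}} \right) + \frac{4}{15}\left( \frac{1}{7^{k-1}} - \frac{1}{10^{k-1}} \right) \right) n \;-\; C\,\frac{\log n}{k}. \]
   Context: For an integer $k\geq 3$, a geometric progression of length $k$ (a $k$-term geometric progression) is a sequence $(a_0,a_1,\ldots,a_{k-1})$ of nonzero real numbers for which there is a real number $r\neq 0,\pm 1$ with $a_i/a_{i-1}=r$ for $i=1,\ldots,k-1$. A set $A$ contains such a progression if $a_0,\ldots,a_{k-1}\in A$. (The paper writes the error term as $O(\log n/k)$; the implied constant is independent of $k$, $n$ and $A$.) -}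

module Defs where

open import Data.Nat as ℕ using (ℕ; zero; suc; _^_; _∸_)
open import Data.Integer using (+_)
open import Data.Rational using (ℚ; _/_; _+_; _-_; _*_; 0ℚ; 1ℚ; -_)
import Data.Rational as ℚ
open import Data.Fin using (Fin; toℕ)
open import Data.Fin.Subset using (Subset; _∈_)
open import Data.Product using (Σ; _×_)
open import Relation.Binary.PropositionalEquality using (_≡_; _≢_)

ℕ→ℚ : ℕ → ℚ
ℕ→ℚ m = + m / 1

-- reciprocal of a natural number (inv 0 = 0 is a junk value, never used
-- in the statement since all denominators there are nonzero)
inv : ℕ → ℚ
inv zero = 0ℚ
inv (suc m) = + 1 / suc m

-- A subset A of {1,…,n} is encoded as a Subset n; the index i : Fin n
-- stands for the integer (toℕ i + 1).
val : ∀ {n} → Fin n → ℕ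
val i = suc (toℕ i)

-- A (⊆ {1..n}) contains a k-term geometric progression:
-- terms a_0,…,a_{k-1} in A and a ratio r ≠ 0, ±1 with a_{i+1} = r a_i.
-- (Terms are positive integers, so any real ratio is a_1/a_0 ∈ ℚ.)
ContainsGP : (k : ℕ) {n : ℕ} → Subset n → Set
ContainsGP k {n} A =
  Σ (Fin k → Fin n) λ a →
  Σ ℚ λ r →
    (∀ i → a i ∈ A) ×
    (r ≢ 0ℚ) × (r ≢ 1ℚ) × (r ≢ - 1ℚ) ×
    (∀ (i j : Fin k) → toℕ j ≡ suc (toℕ i) → ℕ→ℚ (val (a j)) ≡ r * ℕ→ℚ (val (a i)))

coeff : ℕ → ℚ
coeff k =
  inv (2 ^ k ∸ 1)
  + (+ 2 / 5) * (inv (5 ^ (k ∸ 1)) - inv (6 ^ (k ∸ 1)))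
  + (+ 4 / 15) * (inv (7 ^ (k ∸ 1)) - inv (10 ^ (k ∸ 1)))

{-# OPTIONS --safe #-}
module Submission where

-- Every k-term geometric progression inside {1, …, n} misses A, so n − |A| is at least the size of any family
-- of pairwise disjoint such progressions. Writing K = k − 1, three families are used:
--   2^(k a) t, 2^(k a + 1) t, …, 2^(k a + K) t  for a ≥ 0 and t odd, about n / (2^k − 1) − (log₂ n) / (2 k) of them;
--   3^K t, 3^(K − 1) 5 t, …, 5^K t  for t prime to 10 with n / 6^K < t ≤ n / 5^K, about (2 / 5) (n / 5^K − n / 6^K);
--   5^K t, 5^(K − 1) 7 t, …, 7^K t  for t prime to 30 with n / 10^K < t ≤ n / 7^K, about (4 / 15) (n / 7^K − n / 10^K).
-- Within a family, progressions are told apart by 2- or 5-adic valuations. Across families, the terms of the last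
-- two are odd and too large to be odd terms of the first, and the second meets the third only in a term 5^K t,
-- which the ranges of t exclude. The rounding errors are O(1) per block of exponents, hence O(log n / k) in total.


module NatCast where

  open import Defs
  open import Data.Nat as ℕ using (ℕ; zero; suc)
  open import Data.Integer as ℤ using (+_)
  open import Data.Rational using (_+_; _*_; _≤_; toℚᵘ; 1ℚ; NonNegative)
  open import Data.Rational.Properties
  import Data.Rational.Unnormalised as ℚᵘ
  import Data.Rational.Unnormalised.Properties as ℚᵘ
  import Data.Integer.Properties as ℤ
  open import Relation.Binary.PropositionalEquality

  private
    toℚᵘ-ℕ→ℚ : ∀ m → toℚᵘ (ℕ→ℚ m) ℚᵘ.≃ ℚᵘ.mkℚᵘ (+ m) 0
    toℚᵘ-ℕ→ℚ m = toℚᵘ-fromℚᵘ (ℚᵘ.mkℚᵘ (+ m) 0)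

    toℚᵘ-inv : ∀ m → toℚᵘ (inv (suc m)) ℚᵘ.≃ ℚᵘ.mkℚᵘ (+ 1) m
    toℚᵘ-inv m = toℚᵘ-fromℚᵘ (ℚᵘ.mkℚᵘ (+ 1) m)

  ℕ→ℚ-+ : ∀ a b → ℕ→ℚ (a ℕ.+ b) ≡ ℕ→ℚ a + ℕ→ℚ b
  ℕ→ℚ-+ a b = toℚᵘ-injective (begin
    toℚᵘ (ℕ→ℚ (a ℕ.+ b))                         ≈⟨ toℚᵘ-ℕ→ℚ (a ℕ.+ b) ⟩
    ℚᵘ.mkℚᵘ (+ (a ℕ.+ b)) 0                       ≈⟨ ℚᵘ.*≡* (cong (ℤ._* + 1) integral) ⟩
    ℚᵘ.mkℚᵘ (+ a) 0 ℚᵘ.+ ℚᵘ.mkℚᵘ (+ b) 0          ≈⟨ ℚᵘ.+-cong (toℚᵘ-ℕ→ℚ a) (toℚᵘ-ℕ→ℚ b) ⟨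
    toℚᵘ (ℕ→ℚ a) ℚᵘ.+ toℚᵘ (ℕ→ℚ b)               ≈⟨ toℚᵘ-homo-+ (ℕ→ℚ a) (ℕ→ℚ b) ⟨
    toℚᵘ (ℕ→ℚ a + ℕ→ℚ b)                         ∎)
    where
    open ℚᵘ.≃-Reasoning
    integral : + (a ℕ.+ b) ≡ + a ℤ.* + 1 ℤ.+ + b ℤ.* + 1
    integral = trans (ℤ.pos-+ a b) (sym (cong₂ ℤ._+_ (ℤ.*-identityʳ (+ a)) (ℤ.*-identityʳ (+ b))))

  ℕ→ℚ-* : ∀ a b → ℕ→ℚ (a ℕ.* b) ≡ ℕ→ℚ a * ℕ→ℚ b
  ℕ→ℚ-* a b = toℚᵘ-injective (begin
    toℚᵘ (ℕ→ℚ (a ℕ.* b))                  ≈⟨ toℚᵘ-ℕ→ℚ (a ℕ.* b) ⟩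
    ℚᵘ.mkℚᵘ (+ (a ℕ.* b)) 0                ≈⟨ ℚᵘ.*≡* (cong (ℤ._* + 1) (ℤ.pos-* a b)) ⟩
    ℚᵘ.mkℚᵘ (+ a) 0 ℚᵘ.* ℚᵘ.mkℚᵘ (+ b) 0   ≈⟨ ℚᵘ.*-cong (toℚᵘ-ℕ→ℚ a) (toℚᵘ-ℕ→ℚ b) ⟨
    toℚᵘ (ℕ→ℚ a) ℚᵘ.* toℚᵘ (ℕ→ℚ b)        ≈⟨ toℚᵘ-homo-* (ℕ→ℚ a) (ℕ→ℚ b) ⟨
    toℚᵘ (ℕ→ℚ a * ℕ→ℚ b)                  ∎)
    where open ℚᵘ.≃-Reasoning

  ℕ→ℚ-mono-≤ : ∀ {a b} → a ℕ.≤ b → ℕ→ℚ a ≤ ℕ→ℚ b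
  ℕ→ℚ-mono-≤ {a} {b} a≤b = toℚᵘ-cancel-≤ (begin
    toℚᵘ (ℕ→ℚ a)      ≃⟨ toℚᵘ-ℕ→ℚ a ⟩
    ℚᵘ.mkℚᵘ (+ a) 0   ≤⟨ ℚᵘ.*≤* (ℤ.*-monoʳ-≤-nonNeg (+ 1) (ℤ.+≤+ a≤b)) ⟩
    ℚᵘ.mkℚᵘ (+ b) 0   ≃⟨ toℚᵘ-ℕ→ℚ b ⟨
    toℚᵘ (ℕ→ℚ b)      ∎)
    where open ℚᵘ.≤-Reasoning

  inv-inverseˡ : ∀ m .{{_ : ℕ.NonZero m}} → inv m * ℕ→ℚ m ≡ 1ℚ
  inv-inverseˡ (suc m) = toℚᵘ-injective (begin
    toℚᵘ (inv (suc m) * ℕ→ℚ (suc m))              ≈⟨ toℚᵘ-homo-* (inv (suc m)) (ℕ→ℚ (suc m)) ⟩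
    toℚᵘ (inv (suc m)) ℚᵘ.* toℚᵘ (ℕ→ℚ (suc m))   ≈⟨ ℚᵘ.*-cong (toℚᵘ-inv m) (toℚᵘ-ℕ→ℚ (suc m)) ⟩
    ℚᵘ.mkℚᵘ (+ 1) m ℚᵘ.* ℚᵘ.mkℚᵘ (+ suc m) 0      ≈⟨ ℚᵘ.*≡* (trans (ℤ.*-identityʳ _) (cong (λ x → + 1 ℤ.* + x) (sym (ℕ.*-identityʳ (suc m))))) ⟩
    ℚᵘ.1ℚᵘ                                        ∎)
    where
    open ℚᵘ.≃-Reasoning
    import Data.Nat.Properties as ℕ

  ℕ→ℚ-ratio : ∀ p q x y → suc q ℕ.* y ≡ p ℕ.* x → ℕ→ℚ y ≡ (ℕ→ℚ p * inv (suc q)) * ℕ→ℚ x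
  ℕ→ℚ-ratio p q x y qy≡px = begin
    ℕ→ℚ y                                    ≡⟨ *-identityˡ (ℕ→ℚ y) ⟨
    1ℚ * ℕ→ℚ y                               ≡⟨ cong (_* ℕ→ℚ y) (inv-inverseˡ (suc q)) ⟨
    (inv (suc q) * ℕ→ℚ (suc q)) * ℕ→ℚ y      ≡⟨ *-assoc (inv (suc q)) _ _ ⟩
    inv (suc q) * (ℕ→ℚ (suc q) * ℕ→ℚ y)      ≡⟨ cong (inv (suc q) *_) (ℕ→ℚ-* (suc q) y) ⟨
    inv (suc q) * ℕ→ℚ (suc q ℕ.* y)          ≡⟨ cong (λ z → inv (suc q) * ℕ→ℚ z) qy≡px ⟩
    inv (suc q) * ℕ→ℚ (p ℕ.* x)              ≡⟨ cong (inv (suc q) *_) (ℕ→ℚ-* p x) ⟩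
    inv (suc q) * (ℕ→ℚ p * ℕ→ℚ x)            ≡⟨ *-assoc (inv (suc q)) _ _ ⟨
    (inv (suc q) * ℕ→ℚ p) * ℕ→ℚ x            ≡⟨ cong (_* ℕ→ℚ x) (*-comm (inv (suc q)) (ℕ→ℚ p)) ⟩
    (ℕ→ℚ p * inv (suc q)) * ℕ→ℚ x            ∎
    where open ≡-Reasoning

  inv-nonNeg : ∀ m → NonNegative (inv m)
  inv-nonNeg zero    = _
  inv-nonNeg (suc m) = normalize-nonNeg 1 (suc m)

  ℕ→ℚ-nonNeg : ∀ m → NonNegative (ℕ→ℚ m)
  ℕ→ℚ-nonNeg m = normalize-nonNeg m 1

  ≤-*⇒inv-*-≤ : ∀ m .{{_ : ℕ.NonZero m}} {x y} → x ≤ ℕ→ℚ m * y → inv m * x ≤ y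
  ≤-*⇒inv-*-≤ m {x} {y} x≤my = begin
    inv m * x                ≤⟨ *-monoˡ-≤-nonNeg (inv m) {{inv-nonNeg m}} x≤my ⟩
    inv m * (ℕ→ℚ m * y)      ≡⟨ *-assoc (inv m) _ y ⟨
    (inv m * ℕ→ℚ m) * y      ≡⟨ cong (_* y) (inv-inverseˡ m) ⟩
    1ℚ * y                   ≡⟨ *-identityˡ y ⟩
    y                        ∎
    where open ≤-Reasoning

  *-≤⇒≤-inv-* : ∀ m .{{_ : ℕ.NonZero m}} {x y} → ℕ→ℚ m * y ≤ x → y ≤ inv m * x
  *-≤⇒≤-inv-* m {x} {y} my≤x = begin
    y                        ≡⟨ *-identityˡ y ⟨
    1ℚ * y                   ≡⟨ cong (_* y) (inv-inverseˡ m) ⟨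
    (inv m * ℕ→ℚ m) * y      ≡⟨ *-assoc (inv m) _ y ⟩
    inv m * (ℕ→ℚ m * y)      ≤⟨ *-monoˡ-≤-nonNeg (inv m) {{inv-nonNeg m}} my≤x ⟩
    inv m * x                ∎
    where open ≤-Reasoning

module Arithmetic where

  open import Data.Nat
  open import Data.Nat.Properties
  open import Data.Nat.DivMod
  open import Data.Nat.Divisibility
  open import Data.Nat.Primality
  open import Data.Nat.Solver using (module +-*-Solver)
  open import Data.Nat.Logarithm using (⌊log₂_⌋; ⌊log₂⌋-mono-≤; ⌊log₂[2^n]⌋≡n)
  open import Data.Sum using ([_,_])
  open import Relation.Binary.PropositionalEquality
  open import Relation.Nullary using (¬_; yes; no; contradiction)
  open +-*-Solver

  ¬∣-* : ∀ {p a b} → Prime p → ¬ p ∣ a → ¬ p ∣ b → ¬ p ∣ a * b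
  ¬∣-* {a = a} {b} p-prime p∤a p∤b p∣ab = [ p∤a , p∤b ] (euclidsLemma a b p-prime p∣ab)

  ¬∣-^ : ∀ {p a} e → Prime p → ¬ p ∣ a → ¬ p ∣ a ^ e
  ¬∣-^ zero    p-prime p∤a p∣1 = ¬prime[1] (subst Prime (∣1⇒≡1 p∣1) p-prime)
  ¬∣-^ (suc e) p-prime p∤a     = ¬∣-* p-prime p∤a (¬∣-^ e p-prime p∤a)

  ¬∣-+-multiple : ∀ {d m r} q → d ∣ m → ¬ d ∣ r → ¬ d ∣ m * q + r
  ¬∣-+-multiple q d∣m d∤r d∣mq+r = d∤r (∣m+n∣m⇒∣n d∣mq+r (∣-trans d∣m (m∣m*n q)))

  ¬∣⇒>0 : ∀ {d t} → ¬ d ∣ t → 0 < t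
  ¬∣⇒>0 {d} {zero}  d∤0 = contradiction (d ∣0) d∤0
  ¬∣⇒>0 {d} {suc t} _   = s≤s z≤n

  m>0∧n>0⇒m*n>0 : ∀ {m n} → 0 < m → 0 < n → 0 < m * n
  m>0∧n>0⇒m*n>0 {suc m} {suc n} _ _ = s≤s z≤n

  p^i*x≡p^j*y⇒i≡j : ∀ p .{{_ : NonZero p}} {x y} i j → ¬ p ∣ x → ¬ p ∣ y →
                    p ^ i * x ≡ p ^ j * y → i ≡ j
  p^i*x≡p^j*y⇒i≡j p zero    zero    p∤x p∤y eq = refl
  p^i*x≡p^j*y⇒i≡j p {x} {y} zero    (suc j) p∤x p∤y eq =
    contradiction (divides (p ^ j * y) (trans (sym (+-identityʳ x)) (trans eq (solve 3 (λ p q y → p :* q :* y := q :* y :* p) refl p (p ^ j) y)))) p∤x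
  p^i*x≡p^j*y⇒i≡j p {x} {y} (suc i) zero    p∤x p∤y eq =
    contradiction (divides (p ^ i * x) (trans (sym (+-identityʳ y)) (trans (sym eq) (solve 3 (λ p q x → p :* q :* x := q :* x :* p) refl p (p ^ i) x)))) p∤y
  p^i*x≡p^j*y⇒i≡j p {x} {y} (suc i) (suc j) p∤x p∤y eq =
    cong suc (p^i*x≡p^j*y⇒i≡j p i j p∤x p∤y (*-cancelˡ-≡ _ _ p (trans (sym (*-assoc p (p ^ i) x)) (trans eq (*-assoc p (p ^ j) y)))))

  [k*a+i]/k≡a : ∀ k .{{_ : NonZero k}} a {i} → i < k → (k * a + i) / k ≡ a
  [k*a+i]/k≡a k a {i} i<k = begin
    (k * a + i) / k     ≡⟨ +-distrib-/ (k * a) i remainders<k ⟩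
    k * a / k + i / k   ≡⟨ cong₂ _+_ (trans (/-congˡ (*-comm k a)) (m*n/n≡m a k)) (m<n⇒m/n≡0 i<k) ⟩
    a + 0               ≡⟨ +-identityʳ a ⟩
    a                   ∎
    where
    open ≡-Reasoning
    remainders<k : (k * a) % k + i % k < k
    remainders<k = subst₂ (λ u v → u + v < k) (sym (trans (%-congˡ (*-comm k a)) (m*n%n≡0 a k))) (sym (m<n⇒m%n≡m i<k)) i<k

  m<[1+m/n]*n : ∀ m n .{{_ : NonZero n}} → m < suc (m / n) * n
  m<[1+m/n]*n m n = subst (_< n + (m / n) * n) (sym (m≡m%n+[m/n]*n m n)) (+-monoˡ-< ((m / n) * n) (m%n<n m n))

  ^-distribʳ-* : ∀ a b e → (a * b) ^ e ≡ a ^ e * b ^ e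
  ^-distribʳ-* a b zero    = refl
  ^-distribʳ-* a b (suc e) rewrite ^-distribʳ-* a b e =
    solve 4 (λ a b x y → (a :* b) :* (x :* y) := (a :* x) :* (b :* y)) refl a b (a ^ e) (b ^ e)

  private
    ^-split : ∀ a {K i} → i ≤ K → a ^ K ≡ a ^ (K ∸ i) * a ^ i
    ^-split a {K} {i} i≤K = trans (cong (a ^_) (sym (m∸n+n≡m i≤K))) (^-distribˡ-+-* a (K ∸ i) i)

  ^[K∸i]*^i≤^K : ∀ {a b} K {i} → a ≤ b → i ≤ K → a ^ (K ∸ i) * b ^ i ≤ b ^ K
  ^[K∸i]*^i≤^K {a} {b} K {i} a≤b i≤K =
    subst (a ^ (K ∸ i) * b ^ i ≤_) (sym (^-split b i≤K)) (*-monoˡ-≤ (b ^ i) (^-monoˡ-≤ (K ∸ i) a≤b))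

  ^K≤^[K∸i]*^i : ∀ {a b} K {i} → a ≤ b → i ≤ K → a ^ K ≤ a ^ (K ∸ i) * b ^ i
  ^K≤^[K∸i]*^i {a} {b} K {i} a≤b i≤K =
    subst (_≤ a ^ (K ∸ i) * b ^ i) (sym (^-split a i≤K)) (*-monoʳ-≤ (a ^ (K ∸ i)) (^-monoˡ-≤ i a≤b))

  n<2^[1+⌊log₂n⌋] : ∀ n → n < 2 ^ (1 + ⌊log₂ n ⌋)
  n<2^[1+⌊log₂n⌋] n with 2 ^ (1 + ⌊log₂ n ⌋) ≤? n
  ... | yes 2^[1+L]≤n = contradiction (⌊log₂⌋-mono-≤ 2^[1+L]≤n) (<⇒≱ (≤-reflexive (sym (⌊log₂[2^n]⌋≡n (1 + ⌊log₂ n ⌋)))))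
  ... | no  2^[1+L]≰n = ≰⇒> 2^[1+L]≰n

module Lists where

  open import Data.Nat
  open import Data.Nat.Properties
  open import Data.List using (List; []; _∷_; map; length; _++_)
  open import Data.List.Properties using (length-++; length-map)
  open import Data.List.Relation.Unary.All as All using (All; []; _∷_; reduce)
  import Data.List.Relation.Unary.All.Properties as All
  open import Data.List.Relation.Unary.AllPairs as AllPairs using (AllPairs; []; _∷_)
  import Data.List.Relation.Unary.AllPairs.Properties as AllPairs
  open import Data.Product using (_×_; _,_)
  open import Relation.Binary.PropositionalEquality

  module _ {X Y : Set} {P : X → Set} (f : ∀ {x} → P x → Y) where

    length-reduce : ∀ {xs} (ps : All P xs) → length (reduce f ps) ≡ length xs
    length-reduce []       = refl
    length-reduce (p ∷ ps) = cong suc (length-reduce ps)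

    All-reduce : ∀ {Q : Y → Set} → (∀ {x} (p : P x) → Q (f p)) → ∀ {xs} (ps : All P xs) → All Q (reduce f ps)
    All-reduce Q-f []       = []
    All-reduce Q-f (p ∷ ps) = Q-f p ∷ All-reduce Q-f ps

    AllPairs-reduce : ∀ {R : Y → Y → Set} → (∀ {x y} (p : P x) (q : P y) → x ≢ y → R (f p) (f q)) →
                      ∀ {xs} → AllPairs _≢_ xs → (ps : All P xs) → AllPairs R (reduce f ps)
    AllPairs-reduce {R} R-f []           []       = []
    AllPairs-reduce {R} R-f (x≢xs ∷ xs!) (p ∷ ps) = related x≢xs ps ∷ AllPairs-reduce R-f xs! ps
      where
      related : ∀ {ys} → All (_ ≢_) ys → (qs : All P ys) → All (R (f p)) (reduce f qs)
      related []           []       = []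
      related (x≢y ∷ x≢ys) (q ∷ qs) = R-f p q x≢y ∷ related x≢ys qs

  blocks : ℕ → List ℕ → ℕ → ℕ → List ℕ
  blocks m rs q zero    = []
  blocks m rs q (suc c) = map (λ r → m * q + r) rs ++ blocks m rs (suc q) c

  length-blocks : ∀ m rs q c → length (blocks m rs q c) ≡ length rs * c
  length-blocks m rs q zero    = sym (*-zeroʳ (length rs))
  length-blocks m rs q (suc c) = begin
    length (map _ rs ++ blocks m rs (suc q) c)          ≡⟨ length-++ (map _ rs) ⟩
    length (map _ rs) + length (blocks m rs (suc q) c)  ≡⟨ cong₂ _+_ (length-map _ rs) (length-blocks m rs (suc q) c) ⟩
    length rs + length rs * c                           ≡⟨ *-suc (length rs) c ⟨
    length rs * suc c                                   ∎
    where open ≡-Reasoning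

  All-blocks : ∀ {P : ℕ → Set} m {rs} → All (λ r → ∀ q → P (m * q + r)) rs → ∀ q c → All P (blocks m rs q c)
  All-blocks m Prs q zero    = []
  All-blocks m Prs q (suc c) = All.++⁺ (All.map⁺ (All.map (λ P-r → P-r q) Prs)) (All-blocks m Prs (suc q) c)

  blocks-between : ∀ m {rs} → All (_< m) rs → ∀ q c → All (λ t → m * q ≤ t × t < m * (q + c)) (blocks m rs q c)
  blocks-between m rs<m q zero    = []
  blocks-between m rs<m q (suc c) =
    All.++⁺ (All.map⁺ (All.map (λ r<m → m≤m+n (m * q) _ , <-≤-trans (+-monoʳ-< (m * q) r<m) first-block≤) rs<m))
            (All.map (λ {t} (lower , upper) → ≤-trans (*-monoʳ-≤ m (n≤1+n q)) lower , subst (λ z → t < m * z) (sym (+-suc q c)) upper)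
                     (blocks-between m rs<m (suc q) c))
    where
    first-block≤ : m * q + m ≤ m * (q + suc c)
    first-block≤ = begin
      m * q + m         ≡⟨ +-comm (m * q) m ⟩
      m + m * q         ≡⟨ *-suc m q ⟨
      m * suc q         ≤⟨ *-monoʳ-≤ m (s≤s (m≤m+n q c)) ⟩
      m * suc (q + c)   ≡⟨ cong (m *_) (+-suc q c) ⟨
      m * (q + suc c)   ∎
      where open ≤-Reasoning

  blocks-increasing : ∀ m {rs} → AllPairs _<_ rs → All (_< m) rs → ∀ q c → AllPairs _<_ (blocks m rs q c)
  blocks-increasing m rs↑ rs<m q zero    = []
  blocks-increasing m rs↑ rs<m q (suc c) =
    AllPairs.++⁺ (AllPairs.map⁺ (AllPairs.map (+-monoʳ-< (m * q)) rs↑))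
                 (blocks-increasing m rs↑ rs<m (suc q) c)
                 (All.map⁺ (All.map (λ r<m → All.map (λ (lower , _) → <-≤-trans (+-monoʳ-< (m * q) r<m) (next-block lower))
                                                      (blocks-between m rs<m (suc q) c)) rs<m))
    where
    next-block : ∀ {t} → m * suc q ≤ t → m * q + m ≤ t
    next-block = ≤-trans (≤-reflexive (trans (+-comm (m * q) m) (sym (*-suc m q))))

module Counting where

  open import Defs
  open import Data.Nat as ℕ using (ℕ; suc; _<_; z≤n)
  import Data.Nat.Properties as ℕ
  open import Data.Rational using (ℚ; 0ℚ; 1ℚ; -_; _*_)
  open import Data.Fin using (Fin; toℕ; fromℕ<)
  open import Data.Fin.Properties using (toℕ<n; toℕ-fromℕ<; all?; ¬∀⟶∃¬)
  open import Data.Fin.Subset using (Subset; _∈_; _∉_; ∣_∣; ∁; _-_)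
  open import Data.Fin.Subset.Properties
  open import Data.List using (List; []; _∷_; map; length)
  open import Data.List.Properties using (length-map)
  open import Data.List.Relation.Unary.All as All using (All; []; _∷_)
  open import Data.List.Relation.Unary.AllPairs as AllPairs using (AllPairs; []; _∷_)
  import Data.List.Relation.Unary.AllPairs.Properties as AllPairs
  open import Data.Product using (Σ; _×_; _,_; proj₁; proj₂)
  open import Function using (_∘_)
  open import Relation.Binary.PropositionalEquality
  open import Relation.Nullary using (¬_; yes; no; contradiction)

  distinct⊆p⇒length≤∣p∣ : ∀ {n} (p : Subset n) (xs : List (Fin n)) →
                          AllPairs _≢_ xs → All (_∈ p) xs → length xs ℕ.≤ ∣ p ∣
  distinct⊆p⇒length≤∣p∣ p []       _            _          = z≤n
  distinct⊆p⇒length≤∣p∣ p (x ∷ xs) (x∉xs ∷ xs!) (x∈p ∷ xs⊆p) =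
    ℕ.≤-<-trans (distinct⊆p⇒length≤∣p∣ (p - x) xs xs! (All.zipWith remove (x∉xs , xs⊆p)))
                (x∈p⇒∣p-x∣<∣p∣ x∈p)
    where
    remove : ∀ {y} → x ≢ y × y ∈ p → y ∈ p - x
    remove (x≢y , y∈p) = x∈p∧x≢y⇒x∈p-y y∈p (x≢y ∘ sym)

  distinct⊆∁p⇒length+∣p∣≤n : ∀ {n} (p : Subset n) (xs : List (Fin n)) →
                             AllPairs _≢_ xs → All (_∉ p) xs → length xs ℕ.+ ∣ p ∣ ℕ.≤ n
  distinct⊆∁p⇒length+∣p∣≤n {n} p xs xs! xs∉p = begin
    length xs ℕ.+ ∣ p ∣       ≤⟨ ℕ.+-monoˡ-≤ ∣ p ∣ (distinct⊆p⇒length≤∣p∣ (∁ p) xs xs! (All.map x∉p⇒x∈∁p xs∉p)) ⟩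
    ∣ ∁ p ∣ ℕ.+ ∣ p ∣          ≡⟨ cong (ℕ._+ ∣ p ∣) (∣∁p∣≡n∸∣p∣ p) ⟩
    (n ℕ.∸ ∣ p ∣) ℕ.+ ∣ p ∣    ≡⟨ ℕ.m∸n+n≡m (∣p∣≤n p) ⟩
    n                         ∎
    where open ℕ.≤-Reasoning

  -- Terms are indexed by ℕ; only the first k of them are constrained.
  record GeometricProgression (k n : ℕ) : Set where
    field
      ratio    : ℚ
      ratio≢0  : ratio ≢ 0ℚ
      ratio≢1  : ratio ≢ 1ℚ
      ratio≢-1 : ratio ≢ - 1ℚ
      term     : ℕ → ℕ
      term>0   : ∀ i → i < k → 0 < term i
      term≤n   : ∀ i → i < k → term i ℕ.≤ n
      term-suc : ∀ i → suc i < k → ℕ→ℚ (term (suc i)) ≡ ratio * ℕ→ℚ (term i)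

  open GeometricProgression

  Disjoint : ∀ {k n} → GeometricProgression k n → GeometricProgression k n → Set
  Disjoint {k} g h = ∀ i j → i < k → j < k → term g i ≢ term h j

  private
    toFin : ∀ {n} x → 0 < x → x ℕ.≤ n → Fin n
    toFin (suc x) _ x<n = fromℕ< x<n

    val-toFin : ∀ {n} x (x>0 : 0 < x) (x≤n : x ℕ.≤ n) → val (toFin x x>0 x≤n) ≡ x
    val-toFin (suc x) _ x<n = cong suc (toℕ-fromℕ< x<n)

    element : ∀ {k n} → GeometricProgression k n → Fin k → Fin n
    element g i = toFin (term g (toℕ i)) (term>0 g _ (toℕ<n i)) (term≤n g _ (toℕ<n i))

    val-element : ∀ {k n} (g : GeometricProgression k n) i → val (element g i) ≡ term g (toℕ i)
    val-element g i = val-toFin (term g (toℕ i)) (term>0 g _ (toℕ<n i)) (term≤n g _ (toℕ<n i))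

  MissingTerm : ∀ {k n} → Subset n → GeometricProgression k n → Set
  MissingTerm {k} {n} A g = Σ (Fin n) λ x → x ∉ A × Σ ℕ λ i → i < k × val x ≡ term g i

  missingTerm : ∀ {k n} (A : Subset n) → ¬ ContainsGP k A → (g : GeometricProgression k n) → MissingTerm A g
  missingTerm {k} A noGP g with all? (λ i → element g i ∈? A)
  ... | yes all∈A = contradiction (element g , ratio g , all∈A , ratio≢0 g , ratio≢1 g , ratio≢-1 g , step) noGP
    where
    step : ∀ (i j : Fin k) → toℕ j ≡ suc (toℕ i) → ℕ→ℚ (val (element g j)) ≡ ratio g * ℕ→ℚ (val (element g i))
    step i j j≡1+i = begin
      ℕ→ℚ (val (element g j))          ≡⟨ cong ℕ→ℚ (trans (val-element g j) (cong (term g) j≡1+i)) ⟩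
      ℕ→ℚ (term g (suc (toℕ i)))       ≡⟨ term-suc g (toℕ i) (subst (_< k) j≡1+i (toℕ<n j)) ⟩
      ratio g * ℕ→ℚ (term g (toℕ i))   ≡⟨ cong (λ x → ratio g * ℕ→ℚ x) (val-element g i) ⟨
      ratio g * ℕ→ℚ (val (element g i)) ∎
      where open ≡-Reasoning
  ... | no ¬all∈A with ¬∀⟶∃¬ k (λ i → element g i ∈ A) (λ i → element g i ∈? A) ¬all∈A
  ...   | i , i∉A = element g i , i∉A , toℕ i , toℕ<n i , val-element g i

  disjoint⇒length+∣A∣≤n : ∀ {k n} (A : Subset n) → ¬ ContainsGP k A → (gs : List (GeometricProgression k n)) →
                          AllPairs Disjoint gs → length gs ℕ.+ ∣ A ∣ ℕ.≤ n
  disjoint⇒length+∣A∣≤n {k} {n} A noGP gs gs-disjoint =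
    subst (λ m → m ℕ.+ ∣ A ∣ ℕ.≤ n) (length-map missing gs)
      (distinct⊆∁p⇒length+∣p∣≤n A (map missing gs) (AllPairs.map⁺ (AllPairs.map distinct gs-disjoint)) (missing∉A gs))
    where
    missing : GeometricProgression k n → Fin n
    missing g = proj₁ (missingTerm A noGP g)
    distinct : ∀ {g h} → Disjoint g h → missing g ≢ missing h
    distinct {g} {h} g∩h=∅ eq with missingTerm A noGP g | missingTerm A noGP h
    ... | x , _ , i , i<k , x≡gᵢ | y , _ , j , j<k , y≡hⱼ = g∩h=∅ i j i<k j<k (trans (sym x≡gᵢ) (trans (cong val eq) y≡hⱼ))
    missing∉A : ∀ gs → All (_∉ A) (map missing gs)
    missing∉A []       = []
    missing∉A (g ∷ gs) = proj₁ (proj₂ (missingTerm A noGP g)) ∷ missing∉A gs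

module Families where

  open import Defs
  open NatCast
  open Arithmetic
  open Counting
  open import Data.Nat
  open import Data.Nat.Properties
  open import Data.Nat.Divisibility
  open import Data.Nat.Primality
  open import Data.Nat.Solver using (module +-*-Solver)
  open import Data.Integer using (+_)
  import Data.Rational as ℚ
  open import Data.Product using (_,_)
  open import Relation.Binary.PropositionalEquality
  open import Relation.Nullary using (¬_; contradiction)
  open import Relation.Nullary.Decidable using (toWitness; toWitnessFalse)
  open +-*-Solver

  private
    prime₂ : Prime 2
    prime₂ = toWitness {a? = prime? 2} _
    prime₃ : Prime 3
    prime₃ = toWitness {a? = prime? 3} _
    prime₅ : Prime 5
    prime₅ = toWitness {a? = prime? 5} _

    2∤3 : ¬ 2 ∣ 3
    2∤3 = toWitnessFalse {a? = 2 ∣? 3} _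
    2∤5 : ¬ 2 ∣ 5
    2∤5 = toWitnessFalse {a? = 2 ∣? 5} _
    2∤7 : ¬ 2 ∣ 7
    2∤7 = toWitnessFalse {a? = 2 ∣? 7} _
    3∤5 : ¬ 3 ∣ 5
    3∤5 = toWitnessFalse {a? = 3 ∣? 5} _
    3∤7 : ¬ 3 ∣ 7
    3∤7 = toWitnessFalse {a? = 3 ∣? 7} _
    5∤1 : ¬ 5 ∣ 1
    5∤1 = toWitnessFalse {a? = 5 ∣? 1} _
    5∤3 : ¬ 5 ∣ 3
    5∤3 = toWitnessFalse {a? = 5 ∣? 3} _
    5∤7 : ¬ 5 ∣ 7
    5∤7 = toWitnessFalse {a? = 5 ∣? 7} _

  module _ (K n : ℕ) where

    private
      k : ℕ
      k = suc K

      K∸i≡1+K∸[1+i] : ∀ {i} → suc i < k → K ∸ i ≡ suc (K ∸ suc i)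
      K∸i≡1+K∸[1+i] (s≤s 1+i≤K) = +-∸-assoc 1 1+i≤K

    record Seed₁ (a t : ℕ) : Set where
      field
        2∤t   : ¬ 2 ∣ t
        upper : 2 ^ (k * a + K) * t ≤ n

    record Seed₂ (t : ℕ) : Set where
      field
        2∤t   : ¬ 2 ∣ t
        5∤t   : ¬ 5 ∣ t
        lower : n < 6 ^ K * t
        upper : 5 ^ K * t ≤ n

    record Seed₃ (t : ℕ) : Set where
      field
        2∤t   : ¬ 2 ∣ t
        3∤t   : ¬ 3 ∣ t
        5∤t   : ¬ 5 ∣ t
        lower : n < 10 ^ K * t
        upper : 7 ^ K * t ≤ n

    term₁ : ℕ → ℕ → ℕ → ℕ
    term₁ a t i = 2 ^ (k * a + i) * t

    term₂ : ℕ → ℕ → ℕ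
    term₂ t i = 5 ^ i * (3 ^ (K ∸ i) * t)

    term₃ : ℕ → ℕ → ℕ
    term₃ t i = 5 ^ (K ∸ i) * (7 ^ i * t)

    gp₁ : ∀ a t → Seed₁ a t → GeometricProgression k n
    gp₁ a t s = record
      { ratio = ℕ→ℚ 2 ; ratio≢0 = λ () ; ratio≢1 = λ () ; ratio≢-1 = λ ()
      ; term = term₁ a t
      ; term>0 = λ i _ → m>0∧n>0⇒m*n>0 (m^n>0 2 (k * a + i)) (¬∣⇒>0 (Seed₁.2∤t s))
      ; term≤n = λ i i<k → ≤-trans (*-monoˡ-≤ t (^-monoʳ-≤ 2 (+-monoʳ-≤ (k * a) (s≤s⁻¹ i<k)))) (Seed₁.upper s)
      ; term-suc = λ i _ → ℕ→ℚ-ratio 2 0 (term₁ a t i) (term₁ a t (suc i)) (step i) }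
      where
      step : ∀ i → 1 * term₁ a t (suc i) ≡ 2 * term₁ a t i
      step i = trans (*-identityˡ _) (trans (cong (λ e → 2 ^ e * t) (+-suc (k * a) i)) (*-assoc 2 (2 ^ (k * a + i)) t))

    gp₂ : ∀ t → Seed₂ t → GeometricProgression k n
    gp₂ t s = record
      { ratio = + 5 ℚ./ 3 ; ratio≢0 = λ () ; ratio≢1 = λ () ; ratio≢-1 = λ ()
      ; term = term₂ t
      ; term>0 = λ i _ → m>0∧n>0⇒m*n>0 (m^n>0 5 i) (m>0∧n>0⇒m*n>0 (m^n>0 3 (K ∸ i)) (¬∣⇒>0 (Seed₂.2∤t s)))
      ; term≤n = λ i i<k → ≤-trans (term≤5^K*t (s≤s⁻¹ i<k)) (Seed₂.upper s)
      ; term-suc = λ i 1+i<k → ℕ→ℚ-ratio 5 2 (term₂ t i) (term₂ t (suc i)) (step i 1+i<k) }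
      where
      term≤5^K*t : ∀ {i} → i ≤ K → term₂ t i ≤ 5 ^ K * t
      term≤5^K*t {i} i≤K = subst (_≤ 5 ^ K * t) (solve 3 (λ a b c → (b :* a) :* c := a :* (b :* c)) refl (5 ^ i) (3 ^ (K ∸ i)) t)
                                 (*-monoˡ-≤ t (^[K∸i]*^i≤^K K (s≤s (s≤s (s≤s z≤n))) i≤K))
      step : ∀ i → suc i < k → 3 * term₂ t (suc i) ≡ 5 * term₂ t i
      step i 1+i<k rewrite K∸i≡1+K∸[1+i] 1+i<k =
        solve 3 (λ a b c → con 3 :* ((con 5 :* a) :* (b :* c)) := con 5 :* (a :* ((con 3 :* b) :* c))) refl (5 ^ i) (3 ^ (K ∸ suc i)) t

    gp₃ : ∀ t → Seed₃ t → GeometricProgression k n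
    gp₃ t s = record
      { ratio = + 7 ℚ./ 5 ; ratio≢0 = λ () ; ratio≢1 = λ () ; ratio≢-1 = λ ()
      ; term = term₃ t
      ; term>0 = λ i _ → m>0∧n>0⇒m*n>0 (m^n>0 5 (K ∸ i)) (m>0∧n>0⇒m*n>0 (m^n>0 7 i) (¬∣⇒>0 (Seed₃.2∤t s)))
      ; term≤n = λ i i<k → ≤-trans (term≤7^K*t (s≤s⁻¹ i<k)) (Seed₃.upper s)
      ; term-suc = λ i 1+i<k → ℕ→ℚ-ratio 7 4 (term₃ t i) (term₃ t (suc i)) (step i 1+i<k) }
      where
      term≤7^K*t : ∀ {i} → i ≤ K → term₃ t i ≤ 7 ^ K * t
      term≤7^K*t {i} i≤K = subst (_≤ 7 ^ K * t) (*-assoc (5 ^ (K ∸ i)) (7 ^ i) t)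
                                 (*-monoˡ-≤ t (^[K∸i]*^i≤^K K (s≤s (s≤s (s≤s (s≤s (s≤s z≤n))))) i≤K))
      step : ∀ i → suc i < k → 5 * term₃ t (suc i) ≡ 7 * term₃ t i
      step i 1+i<k rewrite K∸i≡1+K∸[1+i] 1+i<k =
        solve 3 (λ a b c → con 5 :* (a :* ((con 7 :* b) :* c)) := con 7 :* ((con 5 :* a) :* (b :* c))) refl (5 ^ (K ∸ suc i)) (7 ^ i) t

    gp₁-disjoint : ∀ {a t a′ t′} (s : Seed₁ a t) (s′ : Seed₁ a′ t′) → (a , t) ≢ (a′ , t′) → Disjoint (gp₁ a t s) (gp₁ a′ t′ s′)
    gp₁-disjoint {a} {t} {a′} {t′} s s′ seeds≢ i j i<k j<k eq = seeds≢ (cong₂ _,_ a≡a′ t≡t′)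
      where
      exponents≡ : k * a + i ≡ k * a′ + j
      exponents≡ = p^i*x≡p^j*y⇒i≡j 2 _ _ (Seed₁.2∤t s) (Seed₁.2∤t s′) eq
      a≡a′ : a ≡ a′
      a≡a′ = trans (sym ([k*a+i]/k≡a k a i<k)) (trans (cong (_/ k) exponents≡) ([k*a+i]/k≡a k a′ j<k))
        where open import Data.Nat.DivMod using (_/_)
      t≡t′ : t ≡ t′
      t≡t′ = *-cancelˡ-≡ t t′ (2 ^ (k * a + i)) {{m^n≢0 2 (k * a + i)}} (trans eq (cong (λ e → 2 ^ e * t′) (sym exponents≡)))

    gp₂-disjoint : ∀ {t t′} (s : Seed₂ t) (s′ : Seed₂ t′) → t ≢ t′ → Disjoint (gp₂ t s) (gp₂ t′ s′)
    gp₂-disjoint {t} {t′} s s′ t≢t′ i j i<k j<k eq = t≢t′ t≡t′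
      where
      i≡j : i ≡ j
      i≡j = p^i*x≡p^j*y⇒i≡j 5 i j (¬∣-* prime₅ (¬∣-^ (K ∸ i) prime₅ 5∤3) (Seed₂.5∤t s))
                                  (¬∣-* prime₅ (¬∣-^ (K ∸ j) prime₅ 5∤3) (Seed₂.5∤t s′)) eq
      t≡t′ : t ≡ t′
      t≡t′ = *-cancelˡ-≡ t t′ (3 ^ (K ∸ i)) {{m^n≢0 3 (K ∸ i)}}
               (*-cancelˡ-≡ _ _ (5 ^ i) {{m^n≢0 5 i}} (trans eq (cong (λ z → 5 ^ z * (3 ^ (K ∸ z) * t′)) (sym i≡j))))

    gp₃-disjoint : ∀ {t t′} (s : Seed₃ t) (s′ : Seed₃ t′) → t ≢ t′ → Disjoint (gp₃ t s) (gp₃ t′ s′)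
    gp₃-disjoint {t} {t′} s s′ t≢t′ i j i<k j<k eq = t≢t′ t≡t′
      where
      i≡j : i ≡ j
      i≡j = ∸-cancelˡ-≡ (s≤s⁻¹ i<k) (s≤s⁻¹ j<k)
              (p^i*x≡p^j*y⇒i≡j 5 (K ∸ i) (K ∸ j) (¬∣-* prime₅ (¬∣-^ i prime₅ 5∤7) (Seed₃.5∤t s))
                                                  (¬∣-* prime₅ (¬∣-^ j prime₅ 5∤7) (Seed₃.5∤t s′)) eq)
      t≡t′ : t ≡ t′
      t≡t′ = *-cancelˡ-≡ t t′ (7 ^ i) {{m^n≢0 7 i}}
               (*-cancelˡ-≡ _ _ (5 ^ (K ∸ i)) {{m^n≢0 5 (K ∸ i)}} (trans eq (cong (λ z → 5 ^ (K ∸ z) * (7 ^ z * t′)) (sym i≡j))))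

    -- An odd term of the first family is a seed t′ itself, and t′ ≤ n / 2^K.
    odd-term₁ : ∀ {a t′ i y} → Seed₁ a t′ → ¬ 2 ∣ y → term₁ a t′ i ≡ y → 2 ^ K * y ≤ n
    odd-term₁ {a} {t′} {i} {y} s 2∤y eq with k * a + i
    ... | suc e = contradiction (subst (2 ∣_) eq (divides (2 ^ e * t′) (solve 2 (λ b c → (con 2 :* b) :* c := (b :* c) :* con 2) refl (2 ^ e) t′))) 2∤y
    ... | zero  = begin
      2 ^ K * y              ≡⟨ cong (2 ^ K *_) (trans (sym eq) (+-identityʳ t′)) ⟩
      2 ^ K * t′             ≤⟨ *-monoˡ-≤ t′ (^-monoʳ-≤ 2 (m≤n+m K (k * a))) ⟩
      2 ^ (k * a + K) * t′   ≤⟨ Seed₁.upper s ⟩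
      n                      ∎
      where open ≤-Reasoning

    gp₁-gp₂-disjoint : ∀ {a t′ t} (s : Seed₁ a t′) (s′ : Seed₂ t) → Disjoint (gp₁ a t′ s) (gp₂ t s′)
    gp₁-gp₂-disjoint {a} {t′} {t} s s′ i j i<k j<k eq = <⇒≱ (Seed₂.lower s′) (begin
      6 ^ K * t                            ≡⟨ cong (_* t) (^-distribʳ-* 2 3 K) ⟩
      (2 ^ K * 3 ^ K) * t                  ≤⟨ *-monoˡ-≤ t (*-monoʳ-≤ (2 ^ K) (^K≤^[K∸i]*^i K (s≤s (s≤s (s≤s z≤n))) (s≤s⁻¹ j<k))) ⟩
      (2 ^ K * (3 ^ (K ∸ j) * 5 ^ j)) * t  ≡⟨ solve 4 (λ a b c d → (a :* (b :* c)) :* d := a :* (c :* (b :* d))) refl (2 ^ K) (3 ^ (K ∸ j)) (5 ^ j) t ⟩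
      2 ^ K * term₂ t j                    ≤⟨ odd-term₁ s 2∤term eq ⟩
      n                                    ∎)
      where
      open ≤-Reasoning
      2∤term : ¬ 2 ∣ term₂ t j
      2∤term = ¬∣-* prime₂ (¬∣-^ j prime₂ 2∤5) (¬∣-* prime₂ (¬∣-^ (K ∸ j) prime₂ 2∤3) (Seed₂.2∤t s′))

    gp₁-gp₃-disjoint : ∀ {a t′ t} (s : Seed₁ a t′) (s′ : Seed₃ t) → Disjoint (gp₁ a t′ s) (gp₃ t s′)
    gp₁-gp₃-disjoint {a} {t′} {t} s s′ i j i<k j<k eq = <⇒≱ (Seed₃.lower s′) (begin
      10 ^ K * t                           ≡⟨ cong (_* t) (^-distribʳ-* 2 5 K) ⟩
      (2 ^ K * 5 ^ K) * t                  ≤⟨ *-monoˡ-≤ t (*-monoʳ-≤ (2 ^ K) (^K≤^[K∸i]*^i K (s≤s (s≤s (s≤s (s≤s (s≤s z≤n))))) (s≤s⁻¹ j<k))) ⟩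
      (2 ^ K * (5 ^ (K ∸ j) * 7 ^ j)) * t  ≡⟨ solve 4 (λ a b c d → (a :* (b :* c)) :* d := a :* (b :* (c :* d))) refl (2 ^ K) (5 ^ (K ∸ j)) (7 ^ j) t ⟩
      2 ^ K * term₃ t j                    ≤⟨ odd-term₁ s 2∤term eq ⟩
      n                                    ∎)
      where
      open ≤-Reasoning
      2∤term : ¬ 2 ∣ term₃ t j
      2∤term = ¬∣-* prime₂ (¬∣-^ (K ∸ j) prime₂ 2∤5) (¬∣-* prime₂ (¬∣-^ j prime₂ 2∤7) (Seed₃.2∤t s′))

    -- Every term of the second family but the last is divisible by 3 and no term of the third is; the last, 5^K t,
    -- has 5-adic valuation K, so it could only equal 5^K t′ with t′ = t, contradicting n < 6^K t and 7^K t′ ≤ n.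
    gp₂-gp₃-disjoint : ∀ {t t′} (s : Seed₂ t) (s′ : Seed₃ t′) → Disjoint (gp₂ t s) (gp₃ t′ s′)
    gp₂-gp₃-disjoint {t} {t′} s s′ i j i<k j<k eq with K ∸ i in K∸i≡
    ... | suc e = 3∤term₃ (subst (3 ∣_) eq (divides (5 ^ i * (3 ^ e * t)) (solve 3 (λ a b c → a :* ((con 3 :* b) :* c) := (a :* (b :* c)) :* con 3) refl (5 ^ i) (3 ^ e) t)))
      where
      3∤term₃ : ¬ 3 ∣ term₃ t′ j
      3∤term₃ = ¬∣-* prime₃ (¬∣-^ (K ∸ j) prime₃ 3∤5) (¬∣-* prime₃ (¬∣-^ j prime₃ 3∤7) (Seed₃.3∤t s′))
    ... | zero = <⇒≱ (Seed₂.lower s) (begin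
      6 ^ K * t    ≤⟨ *-monoˡ-≤ t (^-monoˡ-≤ K (s≤s (s≤s (s≤s (s≤s (s≤s (s≤s z≤n))))))) ⟩
      7 ^ K * t    ≡⟨ cong (7 ^ K *_) t≡t′ ⟩
      7 ^ K * t′   ≤⟨ Seed₃.upper s′ ⟩
      n            ∎)
      where
      open ≤-Reasoning
      i≡K∸j : i ≡ K ∸ j
      i≡K∸j = p^i*x≡p^j*y⇒i≡j 5 i (K ∸ j) (¬∣-* prime₅ 5∤1 (Seed₂.5∤t s)) (¬∣-* prime₅ (¬∣-^ j prime₅ 5∤7) (Seed₃.5∤t s′)) eq
      j≡0 : j ≡ 0
      j≡0 = ∸-cancelˡ-≡ (s≤s⁻¹ j<k) z≤n (trans (sym i≡K∸j) (≤-antisym (s≤s⁻¹ i<k) (m∸n≡0⇒m≤n K∸i≡)))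
      t≡t′ : t ≡ t′
      t≡t′ = begin-equality
        t              ≡⟨ +-identityʳ t ⟨
        1 * t          ≡⟨ *-cancelˡ-≡ _ _ (5 ^ i) {{m^n≢0 5 i}} (trans eq (cong (λ z → 5 ^ z * (7 ^ j * t′)) (sym i≡K∸j))) ⟩
        7 ^ j * t′     ≡⟨ cong (λ z → 7 ^ z * t′) j≡0 ⟩
        1 * t′         ≡⟨ +-identityʳ t′ ⟩
        t′             ∎

module FirstFamily where

  open import Defs
  open NatCast
  open Counting

  open Arithmetic
  open Lists
  open Families
  open import Data.Nat
  open import Data.Nat.Properties
  open import Data.Nat.DivMod
  open import Data.Nat.Divisibility
  open import Data.Nat.Logarithm using (⌊log₂_⌋)
  open import Data.Nat.Solver using (module +-*-Solver)
  import Data.Rational as ℚ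
  import Data.Rational.Properties as ℚ
  import Data.Rational.Solver as ℚ-Solver
  open import Data.List using (List; []; _∷_; map; length; _++_)
  open import Data.List.Properties using (length-++; length-map)
  open import Data.List.Relation.Unary.All as All using (All; []; _∷_; reduce)
  import Data.List.Relation.Unary.All.Properties as All
  open import Data.List.Relation.Unary.AllPairs as AllPairs using (AllPairs; []; _∷_)
  import Data.List.Relation.Unary.AllPairs.Properties as AllPairs
  open import Data.Product using (_×_; _,_; proj₁; proj₂)
  open import Relation.Binary.PropositionalEquality
  open import Relation.Nullary using (¬_)
  open import Relation.Nullary.Decidable using (toWitnessFalse)

  odds≤ : ℕ → List ℕ
  odds≤ B = blocks 2 (1 ∷ []) 0 ((B + 1) / 2)

  length-odds≤ : ∀ B → length (odds≤ B) ≡ (B + 1) / 2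
  length-odds≤ B = trans (length-blocks 2 (1 ∷ []) 0 ((B + 1) / 2)) (+-identityʳ _)

  odds≤-odd : ∀ B → All (λ t → ¬ 2 ∣ t) (odds≤ B)
  odds≤-odd B = All-blocks 2 ((λ q → ¬∣-+-multiple q ∣-refl (toWitnessFalse {a? = 2 ∣? 1} _)) ∷ []) 0 ((B + 1) / 2)

  odds≤-≤ : ∀ B → All (_≤ B) (odds≤ B)
  odds≤-≤ B = All.map (λ {t} (_ , t<2c) → s≤s⁻¹ (subst (suc t ≤_) (+-comm B 1) (≤-trans t<2c 2c≤B+1)))
                      (blocks-between 2 (s≤s (s≤s z≤n) ∷ []) 0 ((B + 1) / 2))
    where
    2c≤B+1 : 2 * ((B + 1) / 2) ≤ B + 1
    2c≤B+1 = subst (_≤ B + 1) (*-comm ((B + 1) / 2) 2) (m/n*n≤m (B + 1) 2)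

  odds≤-increasing : ∀ B → AllPairs _<_ (odds≤ B)
  odds≤-increasing B = blocks-increasing 2 (All.[] ∷ []) (s≤s (s≤s z≤n) ∷ []) 0 ((B + 1) / 2)

  module _ (K n : ℕ) where

    private
      k : ℕ
      k = suc K

      P : ℕ
      P = 2 ^ k

      instance
        P≢0 : NonZero P
        P≢0 = m^n≢0 2 k

      1+[P∸1]≡P : suc (P ∸ 1) ≡ P
      1+[P∸1]≡P = trans (+-comm 1 (P ∸ 1)) (m∸n+n≡m (m^n>0 2 k))

    -- B bounds the odd parts t of the seeds (a , t) with the first block index a; it shrinks by a factor P per block.
    seeds₁ : ℕ → ℕ → ℕ → List (ℕ × ℕ)
    seeds₁ a B zero    = []
    seeds₁ a B (suc D) = map (a ,_) (odds≤ B) ++ seeds₁ (suc a) (B / P) D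

    count₁ : ℕ → ℕ → ℕ
    count₁ B zero    = 0
    count₁ B (suc D) = (B + 1) / 2 + count₁ (B / P) D

    length-seeds₁ : ∀ a B D → length (seeds₁ a B D) ≡ count₁ B D
    length-seeds₁ a B zero    = refl
    length-seeds₁ a B (suc D) = begin
      length (map (a ,_) (odds≤ B) ++ seeds₁ (suc a) (B / P) D)         ≡⟨ length-++ (map (a ,_) (odds≤ B)) ⟩
      length (map (a ,_) (odds≤ B)) + length (seeds₁ (suc a) (B / P) D) ≡⟨ cong₂ _+_ (trans (length-map _ (odds≤ B)) (length-odds≤ B)) (length-seeds₁ (suc a) (B / P) D) ⟩
      (B + 1) / 2 + count₁ (B / P) D                                    ∎
      where open ≡-Reasoning

    seeds₁-admissible : ∀ a B D → 2 ^ (k * a + K) * B ≤ n → All (λ s → Seed₁ K n (proj₁ s) (proj₂ s)) (seeds₁ a B D)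
    seeds₁-admissible a B zero    _     = []
    seeds₁-admissible a B (suc D) upper =
      All.++⁺ (All.map⁺ (All.zipWith seed (odds≤-odd B , odds≤-≤ B)))
              (seeds₁-admissible (suc a) (B / P) D next-upper)
      where
      seed : ∀ {t} → ¬ 2 ∣ t × t ≤ B → Seed₁ K n a t
      seed (2∤t , t≤B) = record { 2∤t = 2∤t ; upper = ≤-trans (*-monoʳ-≤ (2 ^ (k * a + K)) t≤B) upper }
      next-upper : 2 ^ (k * suc a + K) * (B / P) ≤ n
      next-upper = begin
        2 ^ (k * suc a + K) * (B / P)      ≡⟨ cong (λ e → 2 ^ e * (B / P)) (solve 3 (λ k a K → k :* (con 1 :+ a) :+ K := (k :* a :+ K) :+ k) refl k a K) ⟩
        2 ^ ((k * a + K) + k) * (B / P)    ≡⟨ cong (_* (B / P)) (^-distribˡ-+-* 2 (k * a + K) k) ⟩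
        (2 ^ (k * a + K) * P) * (B / P)    ≡⟨ *-assoc (2 ^ (k * a + K)) P (B / P) ⟩
        2 ^ (k * a + K) * (P * (B / P))    ≤⟨ *-monoʳ-≤ (2 ^ (k * a + K)) (subst (_≤ B) (*-comm (B / P) P) (m/n*n≤m B P)) ⟩
        2 ^ (k * a + K) * B                ≤⟨ upper ⟩
        n                                  ∎
        where
        open ≤-Reasoning
        open +-*-Solver

    private
      seeds₁-≥ : ∀ a B D → All (λ s → a ≤ proj₁ s) (seeds₁ a B D)
      seeds₁-≥ a B zero    = []
      seeds₁-≥ a B (suc D) = All.++⁺ (All.map⁺ (All.tabulate (λ _ → ≤-refl))) (All.map (≤-trans (n≤1+n a)) (seeds₁-≥ (suc a) (B / P) D))

    seeds₁-distinct : ∀ a B D → AllPairs _≢_ (seeds₁ a B D)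
    seeds₁-distinct a B zero    = []
    seeds₁-distinct a B (suc D) =
      AllPairs.++⁺ (AllPairs.map⁺ (AllPairs.map (λ t<t′ eq → <⇒≢ t<t′ (cong proj₂ eq)) (odds≤-increasing B)))
                   (seeds₁-distinct (suc a) (B / P) D)
                   (All.map⁺ (All.tabulate (λ _ → All.map (λ a<a′ eq → <⇒≢ a<a′ (cong proj₁ eq)) (seeds₁-≥ (suc a) (B / P) D))))

    -- Summing ⌈B / 2⌉ over B, B / P, B / P², … recovers P B / (2 (P ∸ 1)) up to a loss of 1 / 2 per term from the floors.
    count₁-bound : ∀ B D → B < P ^ D → P * B ≤ (P ∸ 1) * (2 * count₁ B D + D)
    count₁-bound zero    zero    _   = subst (_≤ (P ∸ 1) * 0) (sym (*-zeroʳ P)) z≤n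
    count₁-bound (suc B) zero    (s≤s ())
    count₁-bound B       (suc D) B<Pᴰ = begin
      P * B                                  ≡⟨ cong (_* B) (sym 1+[P∸1]≡P) ⟩
      suc d * B                              ≡⟨ +-comm B (d * B) ⟩
      d * B + B                              ≤⟨ +-mono-≤ (*-monoʳ-≤ d B≤2c) B≤d+MP ⟩
      d * (2 * c) + (d + P * M)              ≤⟨ +-monoʳ-≤ (d * (2 * c)) (+-monoʳ-≤ d (count₁-bound M D M<Pᴰ)) ⟩
      d * (2 * c) + (d + d * (2 * count₁ M D + D)) ≡⟨ solve 4 (λ d c g D → d :* (con 2 :* c) :+ (d :+ d :* (con 2 :* g :+ D)) := d :* (con 2 :* (c :+ g) :+ (con 1 :+ D))) refl d c (count₁ M D) D ⟩
      d * (2 * count₁ B (suc D) + suc D)     ∎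
      where
      open ≤-Reasoning
      open +-*-Solver
      d : ℕ
      d = P ∸ 1
      M : ℕ
      M = B / P
      c : ℕ
      c = (B + 1) / 2
      B≤2c : B ≤ 2 * c
      B≤2c = subst (B ≤_) (*-comm c 2) (s≤s⁻¹ (s≤s⁻¹ (subst (λ z → suc z ≤ 2 + c * 2) (+-comm B 1) (m<[1+m/n]*n (B + 1) 2))))
      B≤d+MP : B ≤ d + P * M
      B≤d+MP = s≤s⁻¹ (subst (B <_) (cong₂ _+_ (sym 1+[P∸1]≡P) (*-comm M P)) (m<[1+m/n]*n B P))
      M<Pᴰ : M < P ^ D
      M<Pᴰ = m<n*o⇒m/o<n (subst (B <_) (*-comm P (P ^ D)) B<Pᴰ)

    blocks₁ : ℕ
    blocks₁ = suc (⌊log₂ n ⌋ / k)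

    private
      instance
        2^K≢0 : NonZero (2 ^ K)
        2^K≢0 = m^n≢0 2 K

      N : ℕ
      N = n / 2 ^ K

      N<Pᴰ : N < P ^ blocks₁
      N<Pᴰ = begin-strict
        N                          ≤⟨ m/n≤m n (2 ^ K) ⟩
        n                          <⟨ n<2^[1+⌊log₂n⌋] n ⟩
        2 ^ (1 + ⌊log₂ n ⌋)        ≤⟨ ^-monoʳ-≤ 2 (subst (suc ⌊log₂ n ⌋ ≤_) (*-comm (suc (⌊log₂ n ⌋ / k)) k) (m<[1+m/n]*n ⌊log₂ n ⌋ k)) ⟩
        2 ^ (k * blocks₁)          ≡⟨ ^-*-assoc 2 k blocks₁ ⟨
        P ^ blocks₁                ∎
        where open ≤-Reasoning

    2n≤[P∸1]*[2count₁+blocks₁+1] : 2 * n ≤ (P ∸ 1) * (2 * count₁ N blocks₁ + blocks₁ + 1)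
    2n≤[P∸1]*[2count₁+blocks₁+1] = s≤s⁻¹ (begin
      suc (2 * n)                       ≤⟨ *-monoʳ-< 2 (m<[1+m/n]*n n (2 ^ K)) ⟩
      2 * (suc N * 2 ^ K)               ≡⟨ solve 2 (λ N x → con 2 :* ((con 1 :+ N) :* x) := con 2 :* x :+ con 2 :* x :* N) refl N (2 ^ K) ⟩
      P + P * N                         ≤⟨ +-monoʳ-≤ P (count₁-bound N blocks₁ N<Pᴰ) ⟩
      P + d * (2 * g + blocks₁)         ≡⟨ cong (_+ d * (2 * g + blocks₁)) 1+[P∸1]≡P ⟨
      suc d + d * (2 * g + blocks₁)     ≡⟨ cong suc (solve 3 (λ d g D → d :+ d :* (con 2 :* g :+ D) := d :* (con 2 :* g :+ D :+ con 1)) refl d g blocks₁) ⟩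
      suc (d * (2 * g + blocks₁ + 1))   ∎)
      where
      open ≤-Reasoning
      open +-*-Solver
      d : ℕ
      d = P ∸ 1
      g : ℕ
      g = count₁ N blocks₁

    initial-seeds₁-admissible : All (λ s → Seed₁ K n (proj₁ s) (proj₂ s)) (seeds₁ 0 N blocks₁)
    initial-seeds₁-admissible = seeds₁-admissible 0 N blocks₁ N-upper
      where
      N-upper : 2 ^ (k * 0 + K) * N ≤ n
      N-upper = subst (λ e → 2 ^ (e + K) * N ≤ n) (sym (*-zeroʳ k)) (subst (_≤ n) (*-comm N (2 ^ K)) (m/n*n≤m n (2 ^ K)))

    gps₁ : List (GeometricProgression k n)
    gps₁ = reduce (λ {s} → gp₁ K n (proj₁ s) (proj₂ s)) initial-seeds₁-admissible

    gps₁-disjoint : AllPairs Disjoint gps₁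
    gps₁-disjoint = AllPairs-reduce _ (gp₁-disjoint K n) (seeds₁-distinct 0 N blocks₁) initial-seeds₁-admissible

    gps₁-length : inv (P ∸ 1) ℚ.* ℕ→ℚ n ℚ.≤ ℕ→ℚ (length gps₁) ℚ.+ ℕ→ℚ (suc blocks₁) ℚ.* inv 2
    gps₁-length = ≤-*⇒inv-*-≤ d (begin
      ℕ→ℚ n                                               ≡⟨ solve 1 (λ x → x := con (inv 2) :* (con (ℕ→ℚ 2) :* x)) refl (ℕ→ℚ n) ⟩
      inv 2 ℚ.* (ℕ→ℚ 2 ℚ.* ℕ→ℚ n)                         ≡⟨ cong (inv 2 ℚ.*_) (ℕ→ℚ-* 2 n) ⟨
      inv 2 ℚ.* ℕ→ℚ (2 * n)                               ≤⟨ ℚ.*-monoˡ-≤-nonNeg (inv 2) (ℕ→ℚ-mono-≤ 2n≤[P∸1]*[2count₁+blocks₁+1]) ⟩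
      inv 2 ℚ.* ℕ→ℚ (d * (2 * g + blocks₁ + 1))           ≡⟨ cong (inv 2 ℚ.*_) cast ⟩
      inv 2 ℚ.* (ℕ→ℚ d ℚ.* (ℕ→ℚ 2 ℚ.* ℕ→ℚ g ℚ.+ ℕ→ℚ blocks₁ ℚ.+ ℚ.1ℚ))
          ≡⟨ solve 3 (λ d g D → con (inv 2) :* (d :* (con (ℕ→ℚ 2) :* g :+ D :+ con ℚ.1ℚ)) := d :* (g :+ (con ℚ.1ℚ :+ D) :* con (inv 2))) refl (ℕ→ℚ d) (ℕ→ℚ g) (ℕ→ℚ blocks₁) ⟩
      ℕ→ℚ d ℚ.* (ℕ→ℚ g ℚ.+ (ℚ.1ℚ ℚ.+ ℕ→ℚ blocks₁) ℚ.* inv 2)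
          ≡⟨ cong₂ (λ x y → ℕ→ℚ d ℚ.* (ℕ→ℚ x ℚ.+ y ℚ.* inv 2)) (sym length-gps₁) (sym (ℕ→ℚ-+ 1 blocks₁)) ⟩
      ℕ→ℚ d ℚ.* (ℕ→ℚ (length gps₁) ℚ.+ ℕ→ℚ (suc blocks₁) ℚ.* inv 2) ∎)
      where
      open ℚ.≤-Reasoning
      open ℚ-Solver.+-*-Solver
      d : ℕ
      d = P ∸ 1
      g : ℕ
      g = count₁ N blocks₁
      instance
        d≢0 : NonZero d
        d≢0 = >-nonZero (m<n⇒0<n∸m (*-monoʳ-≤ 2 (m^n>0 2 K)))
      length-gps₁ : length gps₁ ≡ g
      length-gps₁ = trans (length-reduce (λ {s} → gp₁ K n (proj₁ s) (proj₂ s)) initial-seeds₁-admissible) (length-seeds₁ 0 N blocks₁)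
      cast : ℕ→ℚ (d * (2 * g + blocks₁ + 1)) ≡ ℕ→ℚ d ℚ.* (ℕ→ℚ 2 ℚ.* ℕ→ℚ g ℚ.+ ℕ→ℚ blocks₁ ℚ.+ ℚ.1ℚ)
      cast = trans (ℕ→ℚ-* d _) (cong (ℕ→ℚ d ℚ.*_) (trans (ℕ→ℚ-+ (2 * g + blocks₁) 1) (cong (ℚ._+ ℚ.1ℚ) (trans (ℕ→ℚ-+ (2 * g) blocks₁) (cong (ℚ._+ ℕ→ℚ blocks₁) (ℕ→ℚ-* 2 g))))))

module ResidueFamilies where

  open import Defs
  open NatCast
  open Arithmetic
  open Lists
  open Counting
  open Families
  open import Data.Nat
  open import Data.Nat.Properties
  open import Data.Nat.DivMod
  open import Data.Nat.Divisibility
  open import Data.Nat.Solver using (module +-*-Solver)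
  open import Data.List using (List; []; _∷_; length)
  open import Data.List.Relation.Unary.All as All using (All; []; _∷_; all?; reduce)
  open import Data.List.Relation.Unary.AllPairs as AllPairs using (AllPairs; allPairs?)
  open import Data.Product using (_×_; _,_)
  import Data.Rational as ℚ
  import Data.Rational.Properties as ℚ
  import Data.Rational.Solver as ℚ-Solver
  open import Relation.Binary.PropositionalEquality
  open import Relation.Nullary using (¬_; ¬?; yes; no; contradiction)
  open import Relation.Nullary.Decidable using (toWitness; _×-dec_)

  -- The window of integers t with n / A < t ≤ n / U, cut down to whole blocks of m consecutive integers
  -- from m q₀ up to m (q₀ + c).
  module ResidueWindow (n m A U : ℕ) .{{_ : NonZero m}} .{{_ : NonZero A}} .{{_ : NonZero U}} where

    α : ℕ
    α = n / A

    β : ℕ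
    β = n / U

    q₀ : ℕ
    q₀ = α / m + 1

    c : ℕ
    c = β / m ∸ q₀

    window-lower : ∀ {t} → m * q₀ ≤ t → n < A * t
    window-lower {t} mq₀≤t = begin-strict
      n            <⟨ m<[1+m/n]*n n A ⟩
      suc α * A    ≡⟨ *-comm (suc α) A ⟩
      A * suc α    ≤⟨ *-monoʳ-≤ A (≤-trans α<mq₀ mq₀≤t) ⟩
      A * t        ∎
      where
      open ≤-Reasoning
      open +-*-Solver
      α<mq₀ : α < m * q₀
      α<mq₀ = subst (α <_) (solve 2 (λ m x → (con 1 :+ x) :* m := m :* (x :+ con 1)) refl m (α / m)) (m<[1+m/n]*n α m)

    window-upper : ∀ {t} → m * q₀ ≤ t → t < m * (q₀ + c) → U * t ≤ n
    window-upper {t} mq₀≤t t<m[q₀+c] = begin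
      U * t    ≤⟨ *-monoʳ-≤ U t≤β ⟩
      U * β    ≤⟨ subst (_≤ n) (*-comm β U) (m/n*n≤m n U) ⟩
      n        ∎
      where
      open ≤-Reasoning
      q₀+c≤β/m : q₀ + c ≤ β / m
      q₀+c≤β/m with q₀ ≤? β / m
      ... | yes q₀≤ = ≤-reflexive (m+[n∸m]≡n q₀≤)
      ... | no  q₀≰ = contradiction (≤-<-trans mq₀≤t t<m[q₀+c]) (<-irrefl (begin-equality
        m * q₀         ≡⟨ cong (m *_) (+-identityʳ q₀) ⟨
        m * (q₀ + 0)   ≡⟨ cong (λ z → m * (q₀ + z)) (m≤n⇒m∸n≡0 (≰⇒≥ q₀≰)) ⟨
        m * (q₀ + c)   ∎))
      t≤β : t ≤ β
      t≤β = <⇒≤ (<-≤-trans t<m[q₀+c] (≤-trans (*-monoʳ-≤ m q₀+c≤β/m) (subst (_≤ β) (*-comm (β / m) m) (m/n*n≤m β m))))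

    window-length : β ≤ m * c + 2 * m + α
    window-length = <⇒≤ (begin-strict
      β                            <⟨ m<[1+m/n]*n β m ⟩
      m + (β / m) * m              ≤⟨ +-monoʳ-≤ m (*-monoˡ-≤ m (m≤n+m∸n (β / m) q₀)) ⟩
      m + (q₀ + c) * m             ≡⟨ solve 3 (λ m x c → m :+ ((x :+ con 1) :+ c) :* m := m :* c :+ con 2 :* m :+ x :* m) refl m (α / m) c ⟩
      m * c + 2 * m + (α / m) * m  ≤⟨ +-monoʳ-≤ (m * c + 2 * m) (m/n*n≤m α m) ⟩
      m * c + 2 * m + α            ∎)
      where
      open ≤-Reasoning
      open +-*-Solver

    window-difference : inv U ℚ.* ℕ→ℚ n ℚ.- inv A ℚ.* ℕ→ℚ n ℚ.≤ ℕ→ℚ (suc (m * c + 2 * m))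
    window-difference = begin
      inv U ℚ.* ℕ→ℚ n ℚ.- inv A ℚ.* ℕ→ℚ n            ≤⟨ ℚ.+-mono-≤ n/U≤1+β (ℚ.neg-antimono-≤ α≤n/A) ⟩
      ℕ→ℚ (suc β) ℚ.- ℕ→ℚ α                          ≤⟨ ℚ.+-monoˡ-≤ (ℚ.- ℕ→ℚ α) (subst (ℕ→ℚ (suc β) ℚ.≤_) (ℕ→ℚ-+ X α) (ℕ→ℚ-mono-≤ (s≤s window-length))) ⟩
      ℕ→ℚ X ℚ.+ ℕ→ℚ α ℚ.- ℕ→ℚ α                     ≡⟨ solve 2 (λ x a → (x :+ a) :- a := x) refl (ℕ→ℚ X) (ℕ→ℚ α) ⟩
      ℕ→ℚ X                                          ∎
      where
      open ℚ.≤-Reasoning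
      open ℚ-Solver.+-*-Solver
      X : ℕ
      X = suc (m * c + 2 * m)
      n/U≤1+β : inv U ℚ.* ℕ→ℚ n ℚ.≤ ℕ→ℚ (suc β)
      n/U≤1+β = ≤-*⇒inv-*-≤ U (subst (ℕ→ℚ n ℚ.≤_) (trans (cong ℕ→ℚ (*-comm (suc β) U)) (ℕ→ℚ-* U (suc β))) (ℕ→ℚ-mono-≤ (<⇒≤ (m<[1+m/n]*n n U))))
      α≤n/A : ℕ→ℚ α ℚ.≤ inv A ℚ.* ℕ→ℚ n
      α≤n/A = *-≤⇒≤-inv-* A (subst (ℚ._≤ ℕ→ℚ n) (trans (cong ℕ→ℚ (*-comm α A)) (ℕ→ℚ-* A α)) (ℕ→ℚ-mono-≤ (m/n*n≤m n A)))

    window-length-ℚ : ∀ ρ → (ℕ→ℚ ρ ℚ.* inv m) ℚ.* (inv U ℚ.* ℕ→ℚ n ℚ.- inv A ℚ.* ℕ→ℚ n)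
                            ℚ.≤ ℕ→ℚ (ρ * c) ℚ.+ (ℕ→ℚ (2 * ρ) ℚ.+ ℕ→ℚ ρ ℚ.* inv m)
    window-length-ℚ ρ = begin
      r ℚ.* (inv U ℚ.* ℕ→ℚ n ℚ.- inv A ℚ.* ℕ→ℚ n)             ≤⟨ ℚ.*-monoˡ-≤-nonNeg r window-difference ⟩
      r ℚ.* ℕ→ℚ (suc (m * c + 2 * m))                        ≡⟨ cong (r ℚ.*_) cast ⟩
      r ℚ.* (ℚ.1ℚ ℚ.+ (ℕ→ℚ m ℚ.* ℕ→ℚ c ℚ.+ ℕ→ℚ 2 ℚ.* ℕ→ℚ m))  ≡⟨ solve 5 (λ ρ i M C t → (ρ :* i) :* (con ℚ.1ℚ :+ (M :* C :+ t :* M))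
                                                                                 := ρ :* C :* (i :* M) :+ (t :* ρ :* (i :* M) :+ ρ :* i))
                                                                       refl (ℕ→ℚ ρ) (inv m) (ℕ→ℚ m) (ℕ→ℚ c) (ℕ→ℚ 2) ⟩
      ℕ→ℚ ρ ℚ.* ℕ→ℚ c ℚ.* (inv m ℚ.* ℕ→ℚ m) ℚ.+ (ℕ→ℚ 2 ℚ.* ℕ→ℚ ρ ℚ.* (inv m ℚ.* ℕ→ℚ m) ℚ.+ ℕ→ℚ ρ ℚ.* inv m)
        ≡⟨ cong (λ x → ℕ→ℚ ρ ℚ.* ℕ→ℚ c ℚ.* x ℚ.+ (ℕ→ℚ 2 ℚ.* ℕ→ℚ ρ ℚ.* x ℚ.+ ℕ→ℚ ρ ℚ.* inv m)) (inv-inverseˡ m) ⟩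
      ℕ→ℚ ρ ℚ.* ℕ→ℚ c ℚ.* ℚ.1ℚ ℚ.+ (ℕ→ℚ 2 ℚ.* ℕ→ℚ ρ ℚ.* ℚ.1ℚ ℚ.+ ℕ→ℚ ρ ℚ.* inv m)
        ≡⟨ cong₂ (λ x y → x ℚ.+ (y ℚ.+ ℕ→ℚ ρ ℚ.* inv m)) (trans (ℚ.*-identityʳ _) (sym (ℕ→ℚ-* ρ c))) (trans (ℚ.*-identityʳ _) (sym (ℕ→ℚ-* 2 ρ))) ⟩
      ℕ→ℚ (ρ * c) ℚ.+ (ℕ→ℚ (2 * ρ) ℚ.+ ℕ→ℚ ρ ℚ.* inv m)       ∎
      where
      open ℚ.≤-Reasoning
      open ℚ-Solver.+-*-Solver
      r : ℚ.ℚ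
      r = ℕ→ℚ ρ ℚ.* inv m
      instance
        r-nonNeg : ℚ.NonNegative r
        r-nonNeg = ℚ.nonNeg*nonNeg⇒nonNeg (ℕ→ℚ ρ) {{ℕ→ℚ-nonNeg ρ}} (inv m) {{inv-nonNeg m}}
      cast : ℕ→ℚ (suc (m * c + 2 * m)) ≡ ℚ.1ℚ ℚ.+ (ℕ→ℚ m ℚ.* ℕ→ℚ c ℚ.+ ℕ→ℚ 2 ℚ.* ℕ→ℚ m)
      cast = trans (ℕ→ℚ-+ 1 (m * c + 2 * m)) (cong (ℚ.1ℚ ℚ.+_) (trans (ℕ→ℚ-+ (m * c) (2 * m)) (cong₂ ℚ._+_ (ℕ→ℚ-* m c) (ℕ→ℚ-* 2 m))))

  module _ (K n : ℕ) where

    private instance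
      5^K≢0 : NonZero (5 ^ K)
      5^K≢0 = m^n≢0 5 K
      6^K≢0 : NonZero (6 ^ K)
      6^K≢0 = m^n≢0 6 K
      7^K≢0 : NonZero (7 ^ K)
      7^K≢0 = m^n≢0 7 K
      10^K≢0 : NonZero (10 ^ K)
      10^K≢0 = m^n≢0 10 K

    module W₂ = ResidueWindow n 10 (6 ^ K) (5 ^ K)
    module W₃ = ResidueWindow n 30 (10 ^ K) (7 ^ K)

    residues₂ : List ℕ
    residues₂ = 1 ∷ 3 ∷ 7 ∷ 9 ∷ []

    residues₃ : List ℕ
    residues₃ = 1 ∷ 7 ∷ 11 ∷ 13 ∷ 17 ∷ 19 ∷ 23 ∷ 29 ∷ []

    seeds₂ : List ℕ
    seeds₂ = blocks 10 residues₂ W₂.q₀ W₂.c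

    seeds₃ : List ℕ
    seeds₃ = blocks 30 residues₃ W₃.q₀ W₃.c

    length-seeds₂ : length seeds₂ ≡ 4 * W₂.c
    length-seeds₂ = length-blocks 10 residues₂ W₂.q₀ W₂.c

    length-seeds₃ : length seeds₃ ≡ 8 * W₃.c
    length-seeds₃ = length-blocks 30 residues₃ W₃.q₀ W₃.c

    seeds₂-distinct : AllPairs _≢_ seeds₂
    seeds₂-distinct = AllPairs.map <⇒≢ (blocks-increasing 10 (toWitness {a? = allPairs? _<?_ residues₂} _) (toWitness {a? = all? (_<? 10) residues₂} _) W₂.q₀ W₂.c)

    seeds₃-distinct : AllPairs _≢_ seeds₃
    seeds₃-distinct = AllPairs.map <⇒≢ (blocks-increasing 30 (toWitness {a? = allPairs? _<?_ residues₃} _) (toWitness {a? = all? (_<? 30) residues₃} _) W₃.q₀ W₃.c)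

    seeds₂-admissible : All (Seed₂ K n) seeds₂
    seeds₂-admissible = All.zipWith seed (All-blocks 10 coprime W₂.q₀ W₂.c , blocks-between 10 (toWitness {a? = all? (_<? 10) residues₂} _) W₂.q₀ W₂.c)
      where
      coprime : All (λ r → ∀ q → ¬ 2 ∣ 10 * q + r × ¬ 5 ∣ 10 * q + r) residues₂
      coprime = All.map (λ (2∤r , 5∤r) q → ¬∣-+-multiple q (divides 5 refl) 2∤r , ¬∣-+-multiple q (divides 2 refl) 5∤r)
                  (toWitness {a? = all? (λ r → ¬? (2 ∣? r) ×-dec ¬? (5 ∣? r)) residues₂} _)
      seed : ∀ {t} → (¬ 2 ∣ t × ¬ 5 ∣ t) × (10 * W₂.q₀ ≤ t × t < 10 * (W₂.q₀ + W₂.c)) → Seed₂ K n t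
      seed ((2∤t , 5∤t) , (lower , upper)) = record
        { 2∤t = 2∤t ; 5∤t = 5∤t ; lower = W₂.window-lower lower ; upper = W₂.window-upper lower upper }

    seeds₃-admissible : All (Seed₃ K n) seeds₃
    seeds₃-admissible = All.zipWith seed (All-blocks 30 coprime W₃.q₀ W₃.c , blocks-between 30 (toWitness {a? = all? (_<? 30) residues₃} _) W₃.q₀ W₃.c)
      where
      coprime : All (λ r → ∀ q → ¬ 2 ∣ 30 * q + r × ¬ 3 ∣ 30 * q + r × ¬ 5 ∣ 30 * q + r) residues₃
      coprime = All.map (λ (2∤r , 3∤r , 5∤r) q → ¬∣-+-multiple q (divides 15 refl) 2∤r , ¬∣-+-multiple q (divides 10 refl) 3∤r , ¬∣-+-multiple q (divides 6 refl) 5∤r)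
                  (toWitness {a? = all? (λ r → ¬? (2 ∣? r) ×-dec ¬? (3 ∣? r) ×-dec ¬? (5 ∣? r)) residues₃} _)
      seed : ∀ {t} → (¬ 2 ∣ t × ¬ 3 ∣ t × ¬ 5 ∣ t) × (30 * W₃.q₀ ≤ t × t < 30 * (W₃.q₀ + W₃.c)) → Seed₃ K n t
      seed ((2∤t , 3∤t , 5∤t) , (lower , upper)) = record
        { 2∤t = 2∤t ; 3∤t = 3∤t ; 5∤t = 5∤t ; lower = W₃.window-lower lower ; upper = W₃.window-upper lower upper }

    gps₂ : List (GeometricProgression (suc K) n)
    gps₂ = reduce (λ {t} → gp₂ K n t) seeds₂-admissible

    gps₃ : List (GeometricProgression (suc K) n)
    gps₃ = reduce (λ {t} → gp₃ K n t) seeds₃-admissible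

    gps₂-disjoint : AllPairs Disjoint gps₂
    gps₂-disjoint = AllPairs-reduce _ (gp₂-disjoint K n) seeds₂-distinct seeds₂-admissible

    gps₃-disjoint : AllPairs Disjoint gps₃
    gps₃-disjoint = AllPairs-reduce _ (gp₃-disjoint K n) seeds₃-distinct seeds₃-admissible

    gps₂-length : (ℕ→ℚ 4 ℚ.* inv 10) ℚ.* (inv (5 ^ K) ℚ.* ℕ→ℚ n ℚ.- inv (6 ^ K) ℚ.* ℕ→ℚ n)
                  ℚ.≤ ℕ→ℚ (length gps₂) ℚ.+ (ℕ→ℚ (2 * 4) ℚ.+ ℕ→ℚ 4 ℚ.* inv 10)
    gps₂-length = subst (λ x → (ℕ→ℚ 4 ℚ.* inv 10) ℚ.* (inv (5 ^ K) ℚ.* ℕ→ℚ n ℚ.- inv (6 ^ K) ℚ.* ℕ→ℚ n)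
                               ℚ.≤ ℕ→ℚ x ℚ.+ (ℕ→ℚ (2 * 4) ℚ.+ ℕ→ℚ 4 ℚ.* inv 10))
                        (sym (trans (length-reduce (λ {t} → gp₂ K n t) seeds₂-admissible) length-seeds₂))
                        (W₂.window-length-ℚ 4)

    gps₃-length : (ℕ→ℚ 8 ℚ.* inv 30) ℚ.* (inv (7 ^ K) ℚ.* ℕ→ℚ n ℚ.- inv (10 ^ K) ℚ.* ℕ→ℚ n)
                  ℚ.≤ ℕ→ℚ (length gps₃) ℚ.+ (ℕ→ℚ (2 * 8) ℚ.+ ℕ→ℚ 8 ℚ.* inv 30)
    gps₃-length = subst (λ x → (ℕ→ℚ 8 ℚ.* inv 30) ℚ.* (inv (7 ^ K) ℚ.* ℕ→ℚ n ℚ.- inv (10 ^ K) ℚ.* ℕ→ℚ n)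
                               ℚ.≤ ℕ→ℚ x ℚ.+ (ℕ→ℚ (2 * 8) ℚ.+ ℕ→ℚ 8 ℚ.* inv 30))
                        (sym (trans (length-reduce (λ {t} → gp₃ K n t) seeds₃-admissible) length-seeds₃))
                        (W₃.window-length-ℚ 8)

open import Defs
open NatCast
open Counting
open Lists
open Families
open FirstFamily
open ResidueFamilies
open import Data.Nat as ℕ using (ℕ; suc; _^_; _∸_; s≤s)
import Data.Nat.Properties as ℕ
open import Data.Nat.DivMod using (_/_; m/n*n≤m)
open import Data.Nat.Logarithm using (⌊log₂_⌋; ⌊log₂⌋-mono-≤; ⌊log₂[2^n]⌋≡n)
open import Data.Integer using (+_)
open import Data.Rational using (ℚ; _+_; _-_; _*_; _≤_; _<_; 0ℚ)
import Data.Rational as ℚ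
open import Data.Rational.Properties
import Data.Rational.Solver as ℚ-Solver
open import Data.Fin.Subset using (Subset; ∣_∣)
open import Data.List using (List; length; _++_)
open import Data.List.Properties using (length-++)
open import Data.List.Relation.Unary.All as All using (All)
open import Data.List.Relation.Unary.AllPairs using (AllPairs)
import Data.List.Relation.Unary.AllPairs.Properties as AllPairs
open import Data.Product using (Σ; _×_; _,_; uncurry)
open import Relation.Binary.PropositionalEquality
open import Relation.Nullary using (¬_)
open import Relation.Nullary.Decidable using (toWitness)

private
  k*[3*[2+L/k]+148]≤246*L : ∀ K L → 2 ℕ.≤ K → K ℕ.≤ L → suc K ℕ.* (3 ℕ.* (2 ℕ.+ L / suc K) ℕ.+ 148) ℕ.≤ 246 ℕ.* L
  k*[3*[2+L/k]+148]≤246*L K L 2≤K K≤L = begin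
    k ℕ.* (3 ℕ.* (2 ℕ.+ q) ℕ.+ 148)       ≡⟨ solve 2 (λ k q → k :* (con 3 :* (con 2 :+ q) :+ con 148) := con 3 :* (q :* k) :+ con 77 :* (con 2 :* k)) refl k q ⟩
    3 ℕ.* (q ℕ.* k) ℕ.+ 77 ℕ.* (2 ℕ.* k)  ≤⟨ ℕ.+-mono-≤ (ℕ.*-monoʳ-≤ 3 (m/n*n≤m L k)) (ℕ.*-monoʳ-≤ 77 2k≤3L) ⟩
    3 ℕ.* L ℕ.+ 77 ℕ.* (3 ℕ.* L)          ≤⟨ ℕ.m≤m+n _ (12 ℕ.* L) ⟩
    3 ℕ.* L ℕ.+ 77 ℕ.* (3 ℕ.* L) ℕ.+ 12 ℕ.* L ≡⟨ solve 1 (λ L → con 3 :* L :+ con 77 :* (con 3 :* L) :+ con 12 :* L := con 246 :* L) refl L ⟩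
    246 ℕ.* L                             ∎
    where
    open ℕ.≤-Reasoning
    open import Data.Nat.Solver using (module +-*-Solver)
    open +-*-Solver
    k : ℕ
    k = suc K
    q : ℕ
    q = L / k
    2k≤3L : 2 ℕ.* k ℕ.≤ 3 ℕ.* L
    2k≤3L = ℕ.≤-trans (subst (ℕ._≤ K ℕ.+ 2 ℕ.* K) (solve 1 (λ K → con 2 :+ con 2 :* K := con 2 :* (con 1 :+ K)) refl K) (ℕ.+-monoˡ-≤ (2 ℕ.* K) 2≤K))
                      (subst (ℕ._≤ 3 ℕ.* L) (solve 1 (λ K → con 3 :* K := K :+ con 2 :* K) refl K) (ℕ.*-monoʳ-≤ 3 K≤L))

-- The errors of the three families, (2 + ⌊L / k⌋) / 2 and 2 ρ + ρ / m for (ρ , m) = (4 , 10), (8 , 30), total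
-- (3 ⌊L / k⌋ + 154) / 6; since L ≥ K ≥ 2 gives 2 k ≤ 3 L, this is at most 41 L / k.
log-error : ∀ K L → 2 ℕ.≤ K → K ℕ.≤ L →
            ℕ→ℚ (suc (suc (L / suc K))) * inv 2 + (ℕ→ℚ (2 ℕ.* 4) + ℕ→ℚ 4 * inv 10) + (ℕ→ℚ (2 ℕ.* 8) + ℕ→ℚ 8 * inv 30)
              ≤ (+ 41 ℚ./ 1) * ℕ→ℚ L * inv (suc K)
log-error K L 2≤K K≤L = begin
  ℕ→ℚ (2 ℕ.+ q) * inv 2 + e₂ + e₃                    ≡⟨ cong (λ x → x * inv 2 + e₂ + e₃) (ℕ→ℚ-+ 2 q) ⟩
  (ℕ→ℚ 2 + ℕ→ℚ q) * inv 2 + e₂ + e₃                  ≡⟨ solve 1 (λ q → (con (ℕ→ℚ 2) :+ q) :* con (inv 2) :+ con e₂ :+ con e₃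
                                                                       := con (inv 6) :* (con (ℕ→ℚ 3) :* (con (ℕ→ℚ 2) :+ q) :+ con (ℕ→ℚ 148))) refl (ℕ→ℚ q) ⟩
  inv 6 * (ℕ→ℚ 3 * (ℕ→ℚ 2 + ℕ→ℚ q) + ℕ→ℚ 148)       ≡⟨ cong (inv 6 *_) cast ⟨
  inv 6 * ℕ→ℚ X                                       ≤⟨ *-monoˡ-≤-nonNeg (inv 6) {{inv-nonNeg 6}} (*-≤⇒≤-inv-* k kX≤246L) ⟩
  inv 6 * (inv k * ℕ→ℚ (246 ℕ.* L))                  ≡⟨ cong (λ x → inv 6 * (inv k * x)) (ℕ→ℚ-* 246 L) ⟩
  inv 6 * (inv k * (ℕ→ℚ 246 * ℕ→ℚ L))                ≡⟨ solve 2 (λ i L → con (inv 6) :* (i :* (con (ℕ→ℚ 246) :* L)) := con (+ 41 ℚ./ 1) :* L :* i) refl (inv k) (ℕ→ℚ L) ⟩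
  (+ 41 ℚ./ 1) * ℕ→ℚ L * inv k                         ∎
  where
  open ≤-Reasoning
  open ℚ-Solver.+-*-Solver
  k : ℕ
  k = suc K
  q : ℕ
  q = L / k
  X : ℕ
  X = 3 ℕ.* (2 ℕ.+ q) ℕ.+ 148
  e₂ : ℚ
  e₂ = ℕ→ℚ (2 ℕ.* 4) + ℕ→ℚ 4 * inv 10
  e₃ : ℚ
  e₃ = ℕ→ℚ (2 ℕ.* 8) + ℕ→ℚ 8 * inv 30
  cast : ℕ→ℚ X ≡ ℕ→ℚ 3 * (ℕ→ℚ 2 + ℕ→ℚ q) + ℕ→ℚ 148
  cast = trans (ℕ→ℚ-+ (3 ℕ.* (2 ℕ.+ q)) 148) (cong (_+ ℕ→ℚ 148) (trans (ℕ→ℚ-* 3 (2 ℕ.+ q)) (cong (ℕ→ℚ 3 *_) (ℕ→ℚ-+ 2 q))))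
  kX≤246L : ℕ→ℚ k * ℕ→ℚ X ≤ ℕ→ℚ (246 ℕ.* L)
  kX≤246L = subst (_≤ ℕ→ℚ (246 ℕ.* L)) (ℕ→ℚ-* k X) (ℕ→ℚ-mono-≤ (k*[3*[2+L/k]+148]≤246*L K L 2≤K K≤L))

p+r≤q⇒p≤q-r : ∀ {p q r} → p + r ≤ q → p ≤ q - r
p+r≤q⇒p≤q-r {p} {q} {r} p+r≤q = begin
  p              ≡⟨ solve 2 (λ p r → p := p :+ r :- r) refl p r ⟩
  p + r - r      ≤⟨ +-monoˡ-≤ (ℚ.- r) p+r≤q ⟩
  q - r          ∎
  where
  open ≤-Reasoning
  open ℚ-Solver.+-*-Solver

coeff-split : ∀ K N → coeff (suc K) * N ≡ inv (2 ^ suc K ∸ 1) * N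
                                         + (ℕ→ℚ 4 * inv 10) * (inv (5 ^ K) * N - inv (6 ^ K) * N)
                                         + (ℕ→ℚ 8 * inv 30) * (inv (7 ^ K) * N - inv (10 ^ K) * N)
coeff-split K N = solve 6 (λ i₁ i₅ i₆ i₇ i₁₀ N → (i₁ :+ con (+ 2 ℚ./ 5) :* (i₅ :- i₆) :+ con (+ 4 ℚ./ 15) :* (i₇ :- i₁₀)) :* N
                            := i₁ :* N :+ con (+ 2 ℚ./ 5) :* (i₅ :* N :- i₆ :* N) :+ con (+ 4 ℚ./ 15) :* (i₇ :* N :- i₁₀ :* N))
                          refl (inv (2 ^ suc K ∸ 1)) (inv (5 ^ K)) (inv (6 ^ K)) (inv (7 ^ K)) (inv (10 ^ K)) N
  where open ℚ-Solver.+-*-Solver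

module _ (K n : ℕ) where

  gps : List (GeometricProgression (suc K) n)
  gps = gps₁ K n ++ gps₂ K n ++ gps₃ K n

  gps-disjoint : AllPairs Disjoint gps
  gps-disjoint = AllPairs.++⁺ (gps₁-disjoint K n) (AllPairs.++⁺ (gps₂-disjoint K n) (gps₃-disjoint K n) cross₂₃)
                              (All.zipWith (uncurry All.++⁺) (cross₁₂ , cross₁₃))
    where
    import Data.List.Relation.Unary.All.Properties as All
    cross₁₂ : All (λ g → All (Disjoint g) (gps₂ K n)) (gps₁ K n)
    cross₁₂ = All-reduce _ (λ s → All-reduce _ (gp₁-gp₂-disjoint K n s) (seeds₂-admissible K n)) (initial-seeds₁-admissible K n)
    cross₁₃ : All (λ g → All (Disjoint g) (gps₃ K n)) (gps₁ K n)
    cross₁₃ = All-reduce _ (λ s → All-reduce _ (gp₁-gp₃-disjoint K n s) (seeds₃-admissible K n)) (initial-seeds₁-admissible K n)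
    cross₂₃ : All (λ g → All (Disjoint g) (gps₃ K n)) (gps₂ K n)
    cross₂₃ = All-reduce _ (λ s → All-reduce _ (gp₂-gp₃-disjoint K n s) (seeds₃-admissible K n)) (seeds₂-admissible K n)

  ℕ→ℚ-length-gps : ℕ→ℚ (length gps) ≡ ℕ→ℚ (length (gps₁ K n)) + ℕ→ℚ (length (gps₂ K n)) + ℕ→ℚ (length (gps₃ K n))
  ℕ→ℚ-length-gps = begin
    ℕ→ℚ (length gps)                    ≡⟨ cong ℕ→ℚ (trans (length-++ (gps₁ K n)) (cong (ℓ₁ ℕ.+_) (length-++ (gps₂ K n)))) ⟩
    ℕ→ℚ (ℓ₁ ℕ.+ (ℓ₂ ℕ.+ ℓ₃))            ≡⟨ trans (ℕ→ℚ-+ ℓ₁ (ℓ₂ ℕ.+ ℓ₃)) (cong (λ x → ℕ→ℚ ℓ₁ + x) (ℕ→ℚ-+ ℓ₂ ℓ₃)) ⟩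
    ℕ→ℚ ℓ₁ + (ℕ→ℚ ℓ₂ + ℕ→ℚ ℓ₃)          ≡⟨ +-assoc (ℕ→ℚ ℓ₁) (ℕ→ℚ ℓ₂) (ℕ→ℚ ℓ₃) ⟨
    ℕ→ℚ ℓ₁ + ℕ→ℚ ℓ₂ + ℕ→ℚ ℓ₃            ∎
    where
    open ≡-Reasoning
    ℓ₁ ℓ₂ ℓ₃ : ℕ
    ℓ₁ = length (gps₁ K n)
    ℓ₂ = length (gps₂ K n)
    ℓ₃ = length (gps₃ K n)

  gps-length : 2 ℕ.≤ K → K ℕ.≤ ⌊log₂ n ⌋ →
               coeff (suc K) * ℕ→ℚ n - (+ 41 ℚ./ 1) * ℕ→ℚ ⌊log₂ n ⌋ * inv (suc K) ≤ ℕ→ℚ (length gps)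
  gps-length 2≤K K≤log₂n = begin
    coeff (suc K) * ℕ→ℚ n - c                             ≡⟨ cong (_- c) (coeff-split K (ℕ→ℚ n)) ⟩
    x₁ + x₂ + x₃ - c                                      ≤⟨ +-mono-≤ (+-mono-≤ (+-mono-≤ (gps₁-length K n) (gps₂-length K n)) (gps₃-length K n))
                                                                      (neg-antimono-≤ (log-error K ⌊log₂ n ⌋ 2≤K K≤log₂n)) ⟩
    (ℓ₁ + e₁) + (ℓ₂ + e₂) + (ℓ₃ + e₃) - (e₁ + e₂ + e₃)    ≡⟨ solve 6 (λ ℓ₁ ℓ₂ ℓ₃ e₁ e₂ e₃ → (ℓ₁ :+ e₁) :+ (ℓ₂ :+ e₂) :+ (ℓ₃ :+ e₃) :- (e₁ :+ e₂ :+ e₃)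
                                                                                 := ℓ₁ :+ ℓ₂ :+ ℓ₃) refl ℓ₁ ℓ₂ ℓ₃ e₁ e₂ e₃ ⟩
    ℓ₁ + ℓ₂ + ℓ₃                                          ≡⟨ ℕ→ℚ-length-gps ⟨
    ℕ→ℚ (length gps)                                      ∎
    where
    open ≤-Reasoning
    open ℚ-Solver.+-*-Solver
    c x₁ x₂ x₃ ℓ₁ ℓ₂ ℓ₃ e₁ e₂ e₃ : ℚ
    c  = (+ 41 ℚ./ 1) * ℕ→ℚ ⌊log₂ n ⌋ * inv (suc K)
    x₁ = inv (2 ^ suc K ∸ 1) * ℕ→ℚ n
    x₂ = (ℕ→ℚ 4 * inv 10) * (inv (5 ^ K) * ℕ→ℚ n - inv (6 ^ K) * ℕ→ℚ n)
    x₃ = (ℕ→ℚ 8 * inv 30) * (inv (7 ^ K) * ℕ→ℚ n - inv (10 ^ K) * ℕ→ℚ n)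
    ℓ₁ = ℕ→ℚ (length (gps₁ K n))
    ℓ₂ = ℕ→ℚ (length (gps₂ K n))
    ℓ₃ = ℕ→ℚ (length (gps₃ K n))
    e₁ = ℕ→ℚ (suc (blocks₁ K n)) * inv 2
    e₂ = ℕ→ℚ (2 ℕ.* 4) + ℕ→ℚ 4 * inv 10
    e₃ = ℕ→ℚ (2 ℕ.* 8) + ℕ→ℚ 8 * inv 30

theorem1 : Σ ℚ λ C → (0ℚ < C) ×
    (∀ (k n : ℕ) → 3 ℕ.≤ k → 2 ^ (k ∸ 1) ℕ.≤ n → (A : Subset n) → ¬ ContainsGP k A →
      coeff k * ℕ→ℚ n - C * ℕ→ℚ ⌊log₂ n ⌋ * inv k ≤ ℕ→ℚ n - ℕ→ℚ ∣ A ∣)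
theorem1 = + 41 ℚ./ 1 , toWitness {a? = 0ℚ <? (+ 41 ℚ./ 1)} _ , bound
  where
  bound : ∀ k n → 3 ℕ.≤ k → 2 ^ (k ∸ 1) ℕ.≤ n → (A : Subset n) → ¬ ContainsGP k A →
          coeff k * ℕ→ℚ n - (+ 41 ℚ./ 1) * ℕ→ℚ ⌊log₂ n ⌋ * inv k ≤ ℕ→ℚ n - ℕ→ℚ ∣ A ∣
  bound (suc K) n (s≤s 2≤K) 2^K≤n A noGP = begin
    coeff (suc K) * ℕ→ℚ n - (+ 41 ℚ./ 1) * ℕ→ℚ ⌊log₂ n ⌋ * inv (suc K) ≤⟨ gps-length K n 2≤K K≤log₂n ⟩
    ℕ→ℚ (length (gps K n))                                            ≤⟨ p+r≤q⇒p≤q-r count ⟩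
    ℕ→ℚ n - ℕ→ℚ ∣ A ∣                                                 ∎
    where
    open ≤-Reasoning
    K≤log₂n : K ℕ.≤ ⌊log₂ n ⌋
    K≤log₂n = subst (ℕ._≤ ⌊log₂ n ⌋) (⌊log₂[2^n]⌋≡n K) (⌊log₂⌋-mono-≤ 2^K≤n)
    count : ℕ→ℚ (length (gps K n)) + ℕ→ℚ ∣ A ∣ ≤ ℕ→ℚ n
    count = subst (_≤ ℕ→ℚ n) (ℕ→ℚ-+ (length (gps K n)) ∣ A ∣)
                  (ℕ→ℚ-mono-≤ (disjoint⇒length+∣A∣≤n A noGP (gps K n) (gps-disjoint K n)))
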